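{- Let $\Delta$ be a $d$-dimensional simplicial complex with an assigned gradient vector field $\mathcal{V}$. Let $(\sigma_0^{(k)},\tau_0^{(k-1)})$ be a cancellable critical pair, for some $k \in \{1, \dots, d\}$, and let $\mathcal{W}$ be the gradient vector field obtained by cancelling $(\sigma_0^{(k)},\tau_0^{(k-1)})$ from $\mathcal{V}$. Let $\partial_q^{\mathcal{V}}: C_q^{\mathcal{V}}(\Delta) \rightarrow C_{q-1}^{\mathcal{V}}(\Delta)$ and $\partial_q^{\mathcal{W}}: C_q^{\mathcal{W}}(\Delta) \rightarrow C_{q-1}^{\mathcal{W}}(\Delta)$ be the $q$-th boundary maps of the Morse complexes corresponding to $\mathcal{V}$ and $\mathcal{W}$, respectively. Then the following hold. (1) For $q>k+1$ or $q<k-1$, $\partial_q^{\mathcal{W}}= \partial_q^{\mathcal{V}}$. (2) If $\sigma_1, \dots, \sigma_n$ are the $\mathcal{W}$-critical $k$-simplices, and for any $\mathcal{W}$-critical $(k+1)$-simplex $\beta$, $\partial_{k+1}^{\mathcal{V}}(\beta)= \sum_{j=0}^{n} b_j\sigma_j$, then $\partial_{k+1}^{\mathcal{W}}(\beta)= \sum_{j=1}^{n} b_j\sigma_j$. (3) $\partial_{k-1}^{\mathcal{W}}=\partial_{k-1}^{\mathcal{V}}\big|_{C_{k-1}^{\mathcal{W}}(\Delta)}$. (4) Let $\sigma_0, \sigma_1, \dots, \sigma_n$ be the $\mathcal{V}$-critical $k$-simplices, $\tau_0, \tau_1, \dots, \tau_m$ the $\mathcal{V}$-critical $(k-1)$-simplices,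 and for all $j\in\{0, \dots , n\}$, $\partial_k^{\mathcal{V}}(\sigma_j)= \sum_{i=0}^m a_{ij}\tau_i$. Then for all $j\in\{1, \dots , n\}$, $\partial_k^{\mathcal{W}}(\sigma_j)= \sum_{i=1}^m (a_{ij}-a_{00}a_{0j}a_{i0}) \tau_i$. Equivalently, if $B$ is the matrix of $\partial_k^{\mathcal{V}}$ (rows indexed by $\tau_0,\dots,\tau_m$, columns by $\sigma_0,\dots,\sigma_n$) and $B'$ is obtained from $B$ by the row operations $R_i \mapsto R_i - a_{i0}a_{00}R_0$ for each $i\ge 1$, then the matrix of $\partial_k^{\mathcal{W}}$ is the submatrix of $B'$ obtained by deleting the $0$-th row and $0$-th column.
   Context: Setting: $\Delta$ is a finite abstract simplicial complex with oriented simplices; $\langle \beta,\alpha\rangle\in\{0,\pm1\}$ is the incidence number of a $q$-simplex $\beta$ and a $(q-1)$-simplex $\alpha$. A discrete vector field is a set of pairs $(\alpha,\beta)$ with $\alpha\subsetneq\beta$, $\dim\beta=\dim\alpha+1$, each simplex in at most one pair. A $\mathcal{V}$-trajectory from a $q$-simplex $\beta_0$ to a $(q-1)$-simplex $\alpha_{r+1}$ is a sequence $\beta_0,\alpha_1,\beta_1,\dots,\alpha_r,\beta_r,\alpha_{r+1}$ with $(\alpha_i,\beta_i)\in\mathcal{V}$, $\alpha_{i+1}\ne\alpha_i$, $\alpha_{i+1}\subsetneq\beta_i$, $\alpha_1\subsetneq\beta_0$; its weight is $\prod_{i=1}^r(-\langle\beta_{i-1},\alpha_i\rangle\langle\beta_i,\alpha_i\rangle)\cdot\langle\beta_r,\alpha_{r+1}\rangle$.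 A gradient vector field is a discrete vector field with no nontrivial closed trajectories. A nonempty simplex is $\mathcal{V}$-critical if it lies in no pair of $\mathcal{V}$ (or is a vertex paired with $\emptyset$). $C_q^{\mathcal{V}}(\Delta)$ is the free abelian group on the $\mathcal{V}$-critical $q$-simplices, and the Morse boundary map is $\partial_q^{\mathcal{V}}(\beta)=\sum_{\alpha}\big(\sum_P w(P)\big)\alpha$, summing over $\mathcal{V}$-critical $(q-1)$-simplices $\alpha$ and $\mathcal{V}$-trajectories $P$ from $\beta$ to $\alpha$. A pair of $\mathcal{V}$-critical simplices $(\sigma^{(k)},\tau^{(k-1)})$ is cancellable if there is a unique $\mathcal{V}$-trajectory $\sigma=\beta_0,\alpha_1,\beta_1,\dots,\alpha_r,\beta_r,\alpha_{r+1}=\tau$; cancelling it gives $\mathcal{W}=(\mathcal{V}\setminus\{(\alpha_i,\beta_i):1\le i\le r\})\cup\{(\alpha_{i+1},\beta_i):0\le i\le r\}$, a gradient vector field whose critical simplices are those of $\mathcal{V}$ except $\sigma$ and $\tau$. -}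

module Defs where

open import Data.Nat as ℕ using (ℕ; zero; suc; _≤_)
import Data.Nat.Properties as ℕP
open import Data.Integer as ℤ using (ℤ; 0ℤ; 1ℤ; -1ℤ; _*_; _+_; -_)
open import Data.Sign using (Sign)
open import Data.Bool using (Bool; true; false; if_then_else_; not)
open import Data.Maybe using (Maybe; just; nothing)
open import Data.List using (List; []; _∷_; map; filter; foldr; length; zip; _++_; [_])
import Data.List.Properties as LP
import Data.Product.Properties as PP
open import Data.List.Membership.Propositional using (_∈_)
open import Data.List.Relation.Binary.Subset.Propositional using (_⊆_)
open import Data.List.Relation.Unary.All as All using (All)
open import Data.List.Relation.Unary.Any using (Any)
open import Data.List.Relation.Unary.Linked using (Linked)
open import Data.List.Relation.Unary.Unique.Propositional using (Unique)
import Data.List.Membership.DecPropositional as DecMem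
open import Data.Product using (Σ; _×_; _,_; proj₁; proj₂; ∃)
open import Data.Unit using (⊤)
open import Relation.Binary.PropositionalEquality using (_≡_; _≢_)
open import Relation.Binary.Definitions using (DecidableEquality)
open import Relation.Nullary using (¬_; Dec; yes; no; does; ¬?)
open import Relation.Nullary.Decidable.Core using (_×-dec_; _→-dec_)

-- Simplices.  Vertices are natural numbers; a simplex is the strictly
-- increasing list of its vertices (so the empty list is the empty simplex,
-- and a q-simplex is a list of length q+1).

Simplex : Set
Simplex = List ℕ

_≟ₛ_ : DecidableEquality Simplex
_≟ₛ_ = LP.≡-dec ℕP._≟_

_⊊_ : Simplex → Simplex → Set
α ⊊ β = α ⊆ β × ¬ (β ⊆ α)

-- The orientation of each simplex is given relative to the increasing
-- vertex order by a sign (orient β = + means "oriented by increasing order").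
record Complex : Set where
  field
    simplices : List Simplex
    sorted    : All (Linked ℕ._<_) simplices
    closed    : ∀ {β} → β ∈ simplices → ∀ α → Linked ℕ._<_ α → α ⊆ β → α ∈ simplices
    orient    : Simplex → Sign
open Complex public

HasDim : Complex → ℕ → Set
HasDim Δ d = All (λ β → length β ≤ suc d) (simplices Δ) × Any (λ β → length β ≡ suc d) (simplices Δ)

sumℤ : List ℤ → ℤ
sumℤ = foldr _+_ 0ℤ

signℤ : Sign → ℤ
signℤ Sign.+ = 1ℤ
signℤ Sign.- = -1ℤ

facets : Simplex → List (ℕ × Simplex)
facets [] = []
facets (x ∷ xs) = (0 , xs) ∷ map (λ p → suc (proj₁ p) , x ∷ proj₂ p) (facets xs)

altSign : ℕ → ℤ
altSign zero = 1ℤ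
altSign (suc i) = - altSign i

inc : Complex → Simplex → Simplex → ℤ
inc Δ β α = signℤ (orient Δ β) * signℤ (orient Δ α) *
  sumℤ (map (λ p → if does (proj₂ p ≟ₛ α) then altSign (proj₁ p) else 0ℤ) (facets β))

Pair : Set
Pair = Simplex × Simplex

_≟ₚ_ : DecidableEquality Pair
_≟ₚ_ = PP.≡-dec _≟ₛ_ _≟ₛ_

InPair : Simplex → Pair → Set
InPair s p = s ≡ proj₁ p ⊎' s ≡ proj₂ p
  where
  open import Data.Sum renaming (_⊎_ to _⊎'_)

record DiscreteVectorField (Δ : Complex) (V : List Pair) : Set where
  field
    pairs-in  : All (λ p → proj₁ p ∈ simplices Δ × proj₂ p ∈ simplices Δ) V
    pairs-sub : All (λ p → proj₁ p ⊊ proj₂ p × length (proj₂ p) ≡ suc (length (proj₁ p))) V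
    nodup     : Unique V
    matching  : ∀ {p p'} → p ∈ V → p' ∈ V → ∀ s → InPair s p → InPair s p' → p ≡ p'

NotPrev : Maybe Simplex → Simplex → Set
NotPrev nothing  _ = ⊤
NotPrev (just a) e = a ≢ e

-- Chain V prev β ps e : the sequence  β, α₁, β₁, …, α_r, β_r, e
-- where ps = (α₁,β₁) … (α_r,β_r), each (αᵢ,βᵢ) ∈ V, αᵢ₊₁ ⊊ βᵢ, αᵢ₊₁ ≠ αᵢ,
-- and prev is the α paired with β (if any is to be avoided).
Chain : List Pair → Maybe Simplex → Simplex → List Pair → Simplex → Set
Chain V prev β [] e = e ⊊ β × NotPrev prev e
Chain V prev β ((a , b) ∷ ps) e = (a , b) ∈ V × a ⊊ β × NotPrev prev a × Chain V (just a) b ps e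

Trajectory : List Pair → Simplex → List Pair → Simplex → Set
Trajectory V β₀ ps e = Chain V nothing β₀ ps e

ClosedPath : List Pair → Pair → List Pair → Set
ClosedPath V (a₀ , b₀) ps = (a₀ , b₀) ∈ V × Chain V (just a₀) b₀ ps a₀

GradientVF : Complex → List Pair → Set
GradientVF Δ V = DiscreteVectorField Δ V × (∀ p ps → ¬ ClosedPath V p ps)

Critical : Complex → List Pair → Simplex → Set
Critical Δ V σ = σ ∈ simplices Δ × σ ≢ [] ×
  All (λ p → proj₁ p ≢ σ × (proj₂ p ≡ σ → proj₁ p ≡ [])) V

critical? : ∀ Δ V σ → Dec (Critical Δ V σ)
critical? Δ V σ = (σ ∈? simplices Δ) ×-dec (¬? (σ ≟ₛ [])) ×-dec
  All.all? (λ p → ¬? (proj₁ p ≟ₛ σ) ×-dec ((proj₂ p ≟ₛ σ) →-dec (proj₁ p ≟ₛ []))) V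
  where open DecMem _≟ₛ_ using (_∈?_)

-- Morse boundary.  trajSum n prev β α is the sum of weights of all
-- V-trajectories from β to α using at most n pairs of V.

allowed : Maybe Simplex → Simplex → Bool
allowed nothing  _ = true
allowed (just a) γ = not (does (a ≟ₛ γ))

mutual
  trajSum : Complex → List Pair → ℕ → Maybe Simplex → Simplex → Simplex → ℤ
  trajSum Δ V n prev β α =
    sumℤ (map (λ p → if allowed prev (proj₂ p)
                       then inc Δ β (proj₂ p) * ((if does (proj₂ p ≟ₛ α) then 1ℤ else 0ℤ)
                                                  + cont Δ V n (proj₂ p) α)
                       else 0ℤ)
              (facets β))

  cont : Complex → List Pair → ℕ → Simplex → Simplex → ℤ
  cont Δ V zero γ α = 0ℤ
  cont Δ V (suc n) γ α =
    sumℤ (map (λ p → if does (proj₁ p ≟ₛ γ)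
                       then (- inc Δ (proj₂ p) γ) * trajSum Δ V n (just γ) (proj₂ p) α
                       else 0ℤ) V)

-- For a gradient vector field every V-trajectory from a critical simplex uses
-- distinct pairs of V, so at most (length V) of them: the bound is exhaustive.
∂ : Complex → List Pair → Simplex → Simplex → ℤ
∂ Δ V β α = if does (critical? Δ V α) then trajSum Δ V (length V) nothing β α else 0ℤ

Cancellable : Complex → List Pair → Simplex → Simplex → List Pair → Set
Cancellable Δ V σ τ P = Critical Δ V σ × Critical Δ V τ × Trajectory V σ P τ ×
  (∀ P' → Trajectory V σ P' τ → P' ≡ P)

-- W = (V ∖ {(αᵢ,βᵢ) : 1 ≤ i ≤ r}) ∪ {(αᵢ₊₁,βᵢ) : 0 ≤ i ≤ r}
cancel : List Pair → Simplex → List Pair → Simplex → List Pair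
cancel V σ P τ =
  filter (λ p → ¬? (p ∈? P)) V ++ zip (map proj₁ P ++ [ τ ]) (σ ∷ map proj₂ P)
  where open DecMem _≟ₚ_ using (_∈?_)

module Submission where

-- Cancelling (σ₀, τ₀) reverses the unique V-trajectory P from σ₀
-- to τ₀, which changes only pairs whose lower simplex is a (k−1)-simplex. Trajectories starting
-- away from dimension k are therefore the same for V and W, and apart from σ₀ and τ₀ the critical
-- simplices agree; this gives (1)–(3). From a k-simplex, a W-trajectory may run backwards along P
-- before continuing as a V-trajectory. By induction along W-walks, the W-weight through a facet γ
-- is reach_V(γ, α) − a₀₀ b₀ reach_V(γ, τ₀), where a₀₀ = ±1 is the weight of P and b₀ the coefficient
-- of α in ∂^V(σ₀); summing over the facets of σ gives (4). The bounds are exhaustive because W is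
-- again acyclic: along a W-walk the reversed pairs occur in strictly decreasing position in P.

module MorseCancellation where
  open import Defs
  open import Data.Nat as ℕ using (ℕ; zero; suc; _≤_; _<_; z≤n; s≤s)
  import Data.Nat.Properties as ℕₚ
  open import Data.Integer as ℤ using (ℤ; 0ℤ; 1ℤ; _+_; _*_; -_; _-_)
  import Data.Integer.Properties as ℤₚ
  open import Data.Integer.Tactic.RingSolver using (solve-∀)
  open import Data.Bool using (true; false; if_then_else_)
  open import Data.Maybe using (Maybe; just; nothing)
  open import Data.List using (List; []; _∷_; map; filter; length; zip; _++_; [_]; initLast; _∷ʳ′_)
  import Data.List.Properties as Listₚ
  open import Data.List.Membership.Propositional using (_∈_; _∉_; find; lose)
  open import Data.List.Membership.Propositional.Properties
  import Data.List.Membership.DecPropositional as DecMembership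
  open import Data.List.Relation.Binary.Subset.Propositional using (_⊆_)
  open import Data.List.Relation.Unary.All as All using (All; []; _∷_)
  import Data.List.Relation.Unary.All.Properties as Allₚ
  open import Data.List.Relation.Unary.Any as Any using (Any; here; there)
  open import Data.List.Relation.Unary.AllPairs as AllPairs using (AllPairs; []; _∷_)
  import Data.List.Relation.Unary.AllPairs.Properties as AllPairsₚ
  open import Data.List.Relation.Unary.Linked using (Linked; []; [-]; _∷_)
  import Data.List.Relation.Unary.Linked.Properties as Linkedₚ
  open import Data.List.Relation.Unary.Unique.Propositional using (Unique)
  open import Data.Product using (Σ; _×_; _,_; proj₁; proj₂)
  open import Data.Sum using (_⊎_; inj₁; inj₂)
  open import Data.Unit using (⊤; tt)
  open import Data.Empty using (⊥; ⊥-elim)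
  import Data.Sign as Sign
  open import Function using (_∘_)
  open import Relation.Binary.PropositionalEquality hiding ([_])
  open import Relation.Nullary using (¬_; Dec; yes; no; does; ¬?)
  open import Relation.Nullary.Decidable using (decidable-stable; dec-true; dec-false)

  sumℤ-++ : ∀ xs ys → sumℤ (xs ++ ys) ≡ sumℤ xs + sumℤ ys
  sumℤ-++ [] ys = sym (ℤₚ.+-identityˡ _)
  sumℤ-++ (x ∷ xs) ys = trans (cong (x +_) (sumℤ-++ xs ys)) (sym (ℤₚ.+-assoc x _ _))

  module _ {A : Set} where

    sumℤ-map-cong : ∀ (xs : List A) {f g : A → ℤ} → (∀ {x} → x ∈ xs → f x ≡ g x) →
                    sumℤ (map f xs) ≡ sumℤ (map g xs)
    sumℤ-map-cong [] h = refl
    sumℤ-map-cong (x ∷ xs) h = cong₂ _+_ (h (here refl)) (sumℤ-map-cong xs (h ∘ there))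

    sumℤ-map-zero : ∀ (xs : List A) {f : A → ℤ} → (∀ {x} → x ∈ xs → f x ≡ 0ℤ) → sumℤ (map f xs) ≡ 0ℤ
    sumℤ-map-zero [] h = refl
    sumℤ-map-zero (x ∷ xs) h = cong₂ _+_ (h (here refl)) (sumℤ-map-zero xs (h ∘ there))

    sumℤ-map-scale : ∀ (xs : List A) c (f : A → ℤ) → sumℤ (map (λ x → c * f x) xs) ≡ c * sumℤ (map f xs)
    sumℤ-map-scale [] c f = sym (ℤₚ.*-zeroʳ c)
    sumℤ-map-scale (x ∷ xs) c f =
      trans (cong (c * f x +_) (sumℤ-map-scale xs c f)) (sym (ℤₚ.*-distribˡ-+ c _ _))

    sumℤ-map-sub : ∀ (xs : List A) (f g : A → ℤ) →
                   sumℤ (map (λ x → f x - g x) xs) ≡ sumℤ (map f xs) - sumℤ (map g xs)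
    sumℤ-map-sub [] f g = refl
    sumℤ-map-sub (x ∷ xs) f g =
      trans (cong (f x - g x +_) (sumℤ-map-sub xs f g)) (interchange (f x) (g x) _ _)
      where interchange : ∀ a b c d → a - b + (c - d) ≡ a + c - (b + d)
            interchange = solve-∀

    sumℤ-map-filter : ∀ {Q : A → Set} (Q? : ∀ x → Dec (Q x)) (f : A → ℤ) (xs : List A) →
                      (∀ {x} → x ∈ xs → ¬ Q x → f x ≡ 0ℤ) → sumℤ (map f (filter Q? xs)) ≡ sumℤ (map f xs)
    sumℤ-map-filter Q? f [] h = refl
    sumℤ-map-filter Q? f (x ∷ xs) h with Q? x
    ... | yes _ = cong (f x +_) (sumℤ-map-filter Q? f xs (h ∘ there))
    ... | no ¬q = trans (sumℤ-map-filter Q? f xs (h ∘ there))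
                        (trans (sym (ℤₚ.+-identityˡ _)) (cong (_+ sumℤ (map f xs)) (sym (h (here refl) ¬q))))

    -- select has exactly the shape of the summands of cont (keyed by the lower simplex of a pair)
    -- and of inc (keyed by a facet), so these lemmas apply to Defs' sums definitionally.
    module Select (key : A → Simplex) where

      select : Simplex → (A → ℤ) → A → ℤ
      select s g p = if does (key p ≟ₛ s) then g p else 0ℤ

      select-≢ : ∀ s g p → key p ≢ s → select s g p ≡ 0ℤ
      select-≢ s g p ne with key p ≟ₛ s
      ... | yes e = ⊥-elim (ne e)
      ... | no _ = refl

      select-≡ : ∀ s g p → key p ≡ s → select s g p ≡ g p
      select-≡ s g p e with key p ≟ₛ s
      ... | yes _ = refl
      ... | no ne = ⊥-elim (ne e)

      sumℤ-select-none : ∀ (xs : List A) s g → (∀ {p} → p ∈ xs → key p ≢ s) → sumℤ (map (select s g) xs) ≡ 0ℤ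
      sumℤ-select-none xs s g h = sumℤ-map-zero xs λ {p} p∈ → select-≢ s g p (h p∈)

      sumℤ-select-unique : ∀ (xs : List A) {x} s g → AllPairs (λ p q → key p ≢ key q) xs → x ∈ xs → key x ≡ s →
                           sumℤ (map (select s g) xs) ≡ g x
      sumℤ-select-unique (y ∷ xs) s g (y∉ ∷ _) (here refl) refl =
        trans (cong₂ _+_ (select-≡ (key y) g y refl) (sumℤ-select-none xs (key y) g λ p∈ e → All.lookup y∉ p∈ (sym e)))
              (ℤₚ.+-identityʳ _)
      sumℤ-select-unique (y ∷ xs) s g (y∉ ∷ u) (there x∈) refl =
        trans (cong₂ _+_ (select-≢ _ g y (All.lookup y∉ x∈)) (sumℤ-select-unique xs s g u x∈ refl)) (ℤₚ.+-identityˡ _)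

    ⊆-remove : ∀ {xs : List A} {x} us vs → (∀ {z} → z ∈ xs → z ≢ x) → xs ⊆ us ++ x ∷ vs → xs ⊆ us ++ vs
    ⊆-remove us vs ne sub {z} z∈ with ∈-++⁻ us (sub z∈)
    ... | inj₁ m = ∈-++⁺ˡ m
    ... | inj₂ (here e) = ⊥-elim (ne z∈ e)
    ... | inj₂ (there m) = ∈-++⁺ʳ us m

    unique-⊆⇒length≤ : ∀ {xs ys : List A} → Unique xs → xs ⊆ ys → length xs ≤ length ys
    unique-⊆⇒length≤ {[]} u sub = z≤n
    unique-⊆⇒length≤ {x ∷ xs} {ys} (x∉ ∷ u) sub with ∈-∃++ (sub (here refl))
    ... | us , vs , refl =
      subst (suc (length xs) ≤_) (sym (Listₚ.length-++-sucʳ us x vs))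
        (s≤s (unique-⊆⇒length≤ u (⊆-remove us vs (λ z∈ e → All.lookup x∉ z∈ (sym e)) (sub ∘ there))))

    unique-⊆⇒length< : ∀ {xs ys : List A} {y} → Unique xs → xs ⊆ ys → y ∈ ys → y ∉ xs → length xs < length ys
    unique-⊆⇒length< {xs} {ys} u sub y∈ y∉ with ∈-∃++ y∈
    ... | us , vs , refl =
      subst (suc (length xs) ≤_) (sym (Listₚ.length-++-sucʳ us _ vs))
        (s≤s (unique-⊆⇒length≤ u (⊆-remove us vs (λ z∈ e → y∉ (subst (_∈ xs) e z∈)) sub)))

    unique-split-position : ∀ {x : A} as bs cs ds → Unique (as ++ x ∷ bs) → as ++ x ∷ bs ≡ cs ++ x ∷ ds →
                            length as ≡ length cs
    unique-split-position [] bs [] ds u e = refl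
    unique-split-position [] bs (c ∷ cs) ds (x∉ ∷ u) e with Listₚ.∷-injective e
    ... | refl , e′ = ⊥-elim (All.lookup x∉ (subst (_ ∈_) (sym e′) (∈-++⁺ʳ cs (here refl))) refl)
    unique-split-position (a ∷ as) bs [] ds (a∉ ∷ u) e with Listₚ.∷-injective e
    ... | refl , e′ = ⊥-elim (All.lookup a∉ (∈-++⁺ʳ as (here refl)) refl)
    unique-split-position (a ∷ as) bs (c ∷ cs) ds (_ ∷ u) e =
      cong suc (unique-split-position as bs cs ds u (Listₚ.∷-injectiveʳ e))

    unique-injective⇒distinct : ∀ {B : Set} {key : A → B} {xs : List A} → Unique xs →
                                (∀ {p q} → p ∈ xs → q ∈ xs → key p ≡ key q → p ≡ q) →
                                AllPairs (λ p q → key p ≢ key q) xs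
    unique-injective⇒distinct {xs = []} u inj = []
    unique-injective⇒distinct {xs = x ∷ xs} (x∉ ∷ u) inj =
      All.tabulate (λ q∈ e → All.lookup x∉ q∈ (inj (here refl) (there q∈) e))
      ∷ unique-injective⇒distinct u (λ p∈ q∈ → inj (there p∈) (there q∈))

  Sorted : Simplex → Set
  Sorted = Linked ℕ._<_

  sorted-head : ∀ {x xs} → Sorted (x ∷ xs) → All (x ℕ.<_) xs
  sorted-head [-] = []
  sorted-head (lt ∷ l) = Linkedₚ.Linked⇒All ℕₚ.<-trans lt l

  sorted-tail : ∀ {x xs} → Sorted (x ∷ xs) → Sorted xs
  sorted-tail [-] = []
  sorted-tail (_ ∷ l) = l

  sorted-head∉tail : ∀ {x xs} → Sorted (x ∷ xs) → x ∉ xs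
  sorted-head∉tail s m = ℕₚ.<-irrefl refl (All.lookup (sorted-head s) m)

  sorted-tail-⊆ : ∀ {x xs ys} → Sorted (x ∷ xs) → x ∷ xs ⊆ x ∷ ys → xs ⊆ ys
  sorted-tail-⊆ s sub z∈ with sub (there z∈)
  ... | here refl = ⊥-elim (sorted-head∉tail s z∈)
  ... | there m = m

  sorted⇒unique : ∀ {xs} → Sorted xs → Unique xs
  sorted⇒unique s = AllPairs.map (λ lt e → ℕₚ.<-irrefl e lt) (Linkedₚ.Linked⇒AllPairs ℕₚ.<-trans s)

  open DecMembership ℕ._≟_ using () renaming (_∈?_ to _∈ℕ?_)

  ⊊⇒length< : ∀ {x y} → Sorted x → x ⊊ y → length x < length y
  ⊊⇒length< {x} {y} sx (sub , y⊈x) with Any.any? (λ z → ¬? (z ∈ℕ? x)) y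
  ... | yes new = let (z , z∈y , z∉x) = find new in unique-⊆⇒length< (sorted⇒unique sx) sub z∈y z∉x
  ... | no none = ⊥-elim (y⊈x λ {z} z∈y → decidable-stable (z ∈ℕ? x) (λ z∉x → none (lose z∈y z∉x)))

  sorted-heads-≡ : ∀ {h a x xs} → Sorted (h ∷ a) → Sorted (x ∷ xs) → h ∈ x ∷ xs → x ∈ h ∷ a → h ≡ x
  sorted-heads-≡ sa sb (here e) _ = e
  sorted-heads-≡ sa sb (there _) (here e) = sym e
  sorted-heads-≡ sa sb (there h∈) (there x∈) =
    ⊥-elim (ℕₚ.<-asym (All.lookup (sorted-head sb) h∈) (All.lookup (sorted-head sa) x∈))

  sorted-⊆-length⇒≡ : ∀ {a b} → Sorted a → Sorted b → a ⊆ b → length a ≡ length b → a ≡ b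
  sorted-⊆-length⇒≡ {[]} {[]} _ _ _ _ = refl
  sorted-⊆-length⇒≡ {h ∷ a} {y ∷ ys} sa sb sub len with sub (here refl)
  ... | here refl =
    cong (h ∷_) (sorted-⊆-length⇒≡ (sorted-tail sa) (sorted-tail sb) (sorted-tail-⊆ sa sub) (ℕₚ.suc-injective len))
  ... | there h∈ = ⊥-elim (ℕₚ.<-irrefl len (unique-⊆⇒length< (sorted⇒unique sa) sub (here refl) y∉))
    where y∉ : y ∉ h ∷ a
          y∉ (here refl) = sorted-head∉tail sb h∈
          y∉ (there m) = ℕₚ.<-asym (All.lookup (sorted-head sb) h∈) (All.lookup (sorted-head sa) m)

  facet-⊆ : ∀ β {p} → p ∈ facets β → proj₂ p ⊆ β
  facet-⊆ (x ∷ xs) (here refl) = there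
  facet-⊆ (x ∷ xs) (there m) with ∈-map⁻ _ m
  ... | q , q∈ , refl = λ { (here e) → here e ; (there y∈) → there (facet-⊆ xs q∈ y∈) }

  facet-length : ∀ β {p} → p ∈ facets β → suc (length (proj₂ p)) ≡ length β
  facet-length (x ∷ xs) (here refl) = refl
  facet-length (x ∷ xs) (there m) with ∈-map⁻ _ m
  ... | q , q∈ , refl = cong suc (facet-length xs q∈)

  facet-⊉ : ∀ β {p} → Sorted β → p ∈ facets β → ¬ (β ⊆ proj₂ p)
  facet-⊉ (x ∷ xs) s (here refl) h = sorted-head∉tail s (h (here refl))
  facet-⊉ (x ∷ xs) s (there m) h with ∈-map⁻ _ m
  ... | q , q∈ , refl = facet-⊉ xs (sorted-tail s) q∈ (sorted-tail-⊆ s h)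

  facet-⊊ : ∀ β {p} → Sorted β → p ∈ facets β → proj₂ p ⊊ β
  facet-⊊ β s m = facet-⊆ β m , facet-⊉ β s m

  facets-distinct : ∀ β → Sorted β → AllPairs (λ p q → proj₂ p ≢ proj₂ q) (facets β)
  facets-distinct [] s = []
  facets-distinct (x ∷ xs) s =
    All.tabulate head-missing ∷ AllPairsₚ.map⁺ (AllPairs.map (λ ne e → ne (Listₚ.∷-injectiveʳ e)) (facets-distinct xs (sorted-tail s)))
    where head-missing : ∀ {q} → q ∈ map (λ p → suc (proj₁ p) , x ∷ proj₂ p) (facets xs) → xs ≢ proj₂ q
          head-missing q∈ e with ∈-map⁻ _ q∈
          ... | _ , _ , refl = sorted-head∉tail s (subst (x ∈_) (sym e) (here refl))

  ⊆-facet : ∀ {a b} → Sorted a → Sorted b → a ⊆ b → suc (length a) ≡ length b →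
            Σ (ℕ × Simplex) λ p → p ∈ facets b × proj₂ p ≡ a
  ⊆-facet {a} {x ∷ xs} sa sb sub len with x ∈ℕ? a
  ... | no x∉ = (0 , xs) , here refl , sym (sorted-⊆-length⇒≡ sa (sorted-tail sb) a⊆xs (ℕₚ.suc-injective len))
    where a⊆xs : a ⊆ xs
          a⊆xs {z} z∈ with sub z∈
          ... | here refl = ⊥-elim (x∉ z∈)
          ... | there m = m
  ⊆-facet {h ∷ a} {x ∷ xs} sa sb sub len | yes x∈ with sorted-heads-≡ sa sb (sub (here refl)) x∈
  ... | refl =
    let (p , p∈ , e) = ⊆-facet (sorted-tail sa) (sorted-tail sb) (sorted-tail-⊆ sa sub) (ℕₚ.suc-injective len)
    in (suc (proj₁ p) , h ∷ proj₂ p) , there (∈-map⁺ _ p∈) , cong (h ∷_) e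

  record IsUnit (u : ℤ) : Set where
    constructor isUnit
    field square≡1 : u * u ≡ 1ℤ
  open IsUnit public

  isUnit-* : ∀ {a b} → IsUnit a → IsUnit b → IsUnit (a * b)
  isUnit-* {a} {b} (isUnit aa) (isUnit bb) = isUnit (trans (regroup a b) (cong₂ _*_ aa bb))
    where regroup : ∀ a b → a * b * (a * b) ≡ (a * a) * (b * b)
          regroup = solve-∀

  isUnit-neg : ∀ {a} → IsUnit a → IsUnit (- a)
  isUnit-neg {a} (isUnit aa) = isUnit (trans (squares a) aa)
    where squares : ∀ a → (- a) * (- a) ≡ a * a
          squares = solve-∀

  isUnit-signℤ : ∀ s → IsUnit (signℤ s)
  isUnit-signℤ Sign.- = isUnit refl
  isUnit-signℤ Sign.+ = isUnit refl

  isUnit-altSign : ∀ i → IsUnit (altSign i)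
  isUnit-altSign zero = isUnit refl
  isUnit-altSign (suc i) = isUnit-neg (isUnit-altSign i)

  isUnit-cancel : ∀ {u} x → IsUnit u → u * (u * x) ≡ x
  isUnit-cancel {u} x (isUnit uu) = trans (sym (ℤₚ.*-assoc u u x)) (trans (cong (_* x) uu) (ℤₚ.*-identityˡ x))

  isUnit-*-zero : ∀ {u} x → IsUnit u → u * x ≡ 0ℤ → x ≡ 0ℤ
  isUnit-*-zero {u} x uu e = trans (sym (isUnit-cancel x uu)) (trans (cong (u *_) e) (ℤₚ.*-zeroʳ u))

  allowed→NotPrev : ∀ pr γ → allowed pr γ ≡ true → NotPrev pr γ
  allowed→NotPrev nothing _ _ = tt
  allowed→NotPrev (just a) γ ok with a ≟ₛ γ
  allowed→NotPrev (just a) γ () | yes _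
  ... | no ne = ne

  NotPrev→allowed : ∀ pr γ → NotPrev pr γ → allowed pr γ ≡ true
  NotPrev→allowed nothing _ _ = refl
  NotPrev→allowed (just a) γ ne with a ≟ₛ γ
  ... | yes e = ⊥-elim (ne e)
  ... | no _ = refl

  module Incidence (Δ : Complex) where
    open Select {A = ℕ × Simplex} proj₂
    module BySource = Select {A = Pair} proj₁

    inc-facet≡ : ∀ β {p} → Sorted β → p ∈ facets β →
                 inc Δ β (proj₂ p) ≡ signℤ (orient Δ β) * signℤ (orient Δ (proj₂ p)) * altSign (proj₁ p)
    inc-facet≡ β s m = cong (signℤ (orient Δ β) * signℤ (orient Δ _) *_)
                            (sumℤ-select-unique (facets β) _ (λ p → altSign (proj₁ p)) (facets-distinct β s) m refl)

    inc-isUnit : ∀ β {p} → Sorted β → p ∈ facets β → IsUnit (inc Δ β (proj₂ p))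
    inc-isUnit β {p} s m rewrite inc-facet≡ β s m =
      isUnit-* (isUnit-* (isUnit-signℤ (orient Δ β)) (isUnit-signℤ (orient Δ (proj₂ p)))) (isUnit-altSign (proj₁ p))

    kronecker : Simplex → Simplex → ℤ
    kronecker γ α = if does (γ ≟ₛ α) then 1ℤ else 0ℤ

    kronecker-≢ : ∀ γ α → γ ≢ α → kronecker γ α ≡ 0ℤ
    kronecker-≢ γ α ne with γ ≟ₛ α
    ... | yes e = ⊥-elim (ne e)
    ... | no _ = refl

    kronecker-refl : ∀ γ → kronecker γ γ ≡ 1ℤ
    kronecker-refl γ with γ ≟ₛ γ
    ... | yes _ = refl
    ... | no ne = ⊥-elim (ne refl)

    -- trajSum Δ X n pr β α is facetSum pr β (λ γ → reach X n γ α) by definition.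
    facetSum : Maybe Simplex → Simplex → (Simplex → ℤ) → ℤ
    facetSum pr β h = sumℤ (map (λ p → if allowed pr (proj₂ p) then inc Δ β (proj₂ p) * h (proj₂ p) else 0ℤ) (facets β))

    facetSum-cong : ∀ pr β {g h : Simplex → ℤ} →
                    (∀ {p} → p ∈ facets β → NotPrev pr (proj₂ p) → g (proj₂ p) ≡ h (proj₂ p)) →
                    facetSum pr β g ≡ facetSum pr β h
    facetSum-cong pr β {g} {h} g≗h = sumℤ-map-cong (facets β) λ {p} p∈ → term p p∈
      where term : ∀ p → p ∈ facets β →
                   (if allowed pr (proj₂ p) then inc Δ β (proj₂ p) * g (proj₂ p) else 0ℤ) ≡
                   (if allowed pr (proj₂ p) then inc Δ β (proj₂ p) * h (proj₂ p) else 0ℤ)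
            term p p∈ with allowed pr (proj₂ p) in ok
            ... | false = refl
            ... | true = cong (inc Δ β (proj₂ p) *_) (g≗h p∈ (allowed→NotPrev pr (proj₂ p) ok))

    facetSum-zero : ∀ pr β {h : Simplex → ℤ} →
                    (∀ {p} → p ∈ facets β → NotPrev pr (proj₂ p) → h (proj₂ p) ≡ 0ℤ) → facetSum pr β h ≡ 0ℤ
    facetSum-zero pr β h≗0 = trans (facetSum-cong pr β h≗0) (sumℤ-map-zero (facets β) λ {p} _ → term p)
      where term : ∀ p → (if allowed pr (proj₂ p) then inc Δ β (proj₂ p) * 0ℤ else 0ℤ) ≡ 0ℤ
            term p with allowed pr (proj₂ p)
            ... | false = refl
            ... | true = ℤₚ.*-zeroʳ (inc Δ β (proj₂ p))

    facetSum-single : ∀ pr β {p} (h : Simplex → ℤ) → Sorted β → p ∈ facets β → NotPrev pr (proj₂ p) →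
                      (∀ {q} → q ∈ facets β → NotPrev pr (proj₂ q) → proj₂ q ≢ proj₂ p → h (proj₂ q) ≡ 0ℤ) →
                      facetSum pr β h ≡ inc Δ β (proj₂ p) * h (proj₂ p)
    facetSum-single pr β {p} h s p∈ np others =
      trans (sumℤ-map-cong (facets β) λ {q} q∈ → term q q∈)
            (sumℤ-select-unique (facets β) (proj₂ p) h′ (facets-distinct β s) p∈ refl)
      where
      h′ : ℕ × Simplex → ℤ
      h′ = λ q → inc Δ β (proj₂ q) * h (proj₂ q)
      term : ∀ q → q ∈ facets β → (if allowed pr (proj₂ q) then h′ q else 0ℤ) ≡ select (proj₂ p) h′ q
      term q q∈ with proj₂ q ≟ₛ proj₂ p
      ... | yes q≡p rewrite q≡p | NotPrev→allowed pr (proj₂ p) np = refl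
      ... | no q≢p with allowed pr (proj₂ q) in ok
      ...   | false = refl
      ...   | true = trans (cong (inc Δ β (proj₂ q) *_) (others q∈ (allowed→NotPrev pr (proj₂ q) ok) q≢p))
                           (ℤₚ.*-zeroʳ (inc Δ β (proj₂ q)))

    facetSum-excluding : ∀ β {p} (h : Simplex → ℤ) → Sorted β → p ∈ facets β →
                         facetSum (just (proj₂ p)) β h ≡ facetSum nothing β h - inc Δ β (proj₂ p) * h (proj₂ p)
    facetSum-excluding β {p} h s p∈ =
      trans (sumℤ-map-cong (facets β) (λ {q} _ → term q))
      (trans (sumℤ-map-sub (facets β) h′ (select (proj₂ p) h′))
             (cong (λ z → facetSum nothing β h - z) (sumℤ-select-unique (facets β) (proj₂ p) h′ (facets-distinct β s) p∈ refl)))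
      where
      h′ : ℕ × Simplex → ℤ
      h′ = λ q → inc Δ β (proj₂ q) * h (proj₂ q)
      term : ∀ q → (if allowed (just (proj₂ p)) (proj₂ q) then h′ q else 0ℤ) ≡ h′ q - select (proj₂ p) h′ q
      term q with proj₂ p ≟ₛ proj₂ q | proj₂ q ≟ₛ proj₂ p
      ... | yes _ | yes _ = sym (ℤₚ.+-inverseʳ (h′ q))
      ... | yes e | no ne = ⊥-elim (ne (sym e))
      ... | no ne | yes e = ⊥-elim (ne (sym e))
      ... | no _ | no _ = sym (ℤₚ.+-identityʳ (h′ q))

    facetSum-linear : ∀ β c (f g : Simplex → ℤ) →
                      facetSum nothing β (λ γ → f γ - c * g γ) ≡ facetSum nothing β f - c * facetSum nothing β g
    facetSum-linear β c f g =
      trans (sumℤ-map-cong (facets β) (λ {q} _ → distribute (inc Δ β (proj₂ q)) (f (proj₂ q)) (g (proj₂ q)) c))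
      (trans (sumℤ-map-sub (facets β) (λ q → inc Δ β (proj₂ q) * f (proj₂ q)) (λ q → c * (inc Δ β (proj₂ q) * g (proj₂ q))))
             (cong (λ z → facetSum nothing β f - z) (sumℤ-map-scale (facets β) c (λ q → inc Δ β (proj₂ q) * g (proj₂ q)))))
      where distribute : ∀ i x y c → i * (x - c * y) ≡ i * x - c * (i * y)
            distribute = solve-∀

    -- The weight of all trajectories through the facet γ, including the one stopping at γ = α.
    reach : List Pair → ℕ → Simplex → Simplex → ℤ
    reach X n γ α = kronecker γ α + cont Δ X n γ α

    pathSum : List Pair → ℕ → Simplex → Simplex → ℤ
    pathSum X n β α = trajSum Δ X n nothing β α

    cont-cong : ∀ X {n m} γ α →
                (∀ {β} → (γ , β) ∈ X → trajSum Δ X n (just γ) β α ≡ trajSum Δ X m (just γ) β α) →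
                cont Δ X (suc n) γ α ≡ cont Δ X (suc m) γ α
    cont-cong X {n} {m} γ α eq = sumℤ-map-cong X λ {p} p∈ → term p p∈
      where term : ∀ p → p ∈ X → BySource.select γ (λ q → (- inc Δ (proj₂ q) γ) * trajSum Δ X n (just γ) (proj₂ q) α) p
                                 ≡ BySource.select γ (λ q → (- inc Δ (proj₂ q) γ) * trajSum Δ X m (just γ) (proj₂ q) α) p
            term p p∈ with proj₁ p ≟ₛ γ
            ... | no _ = refl
            ... | yes refl = cong ((- inc Δ (proj₂ p) (proj₁ p)) *_) (eq p∈)

    cont-zero : ∀ X n γ α → (∀ {β} → (γ , β) ∈ X → trajSum Δ X n (just γ) β α ≡ 0ℤ) → cont Δ X (suc n) γ α ≡ 0ℤ
    cont-zero X n γ α eq = sumℤ-map-zero X λ {p} p∈ → term p p∈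
      where term : ∀ p → p ∈ X → BySource.select γ (λ q → (- inc Δ (proj₂ q) γ) * trajSum Δ X n (just γ) (proj₂ q) α) p ≡ 0ℤ
            term p p∈ with proj₁ p ≟ₛ γ
            ... | no _ = refl
            ... | yes refl = trans (cong ((- inc Δ (proj₂ p) (proj₁ p)) *_) (eq p∈)) (ℤₚ.*-zeroʳ (- inc Δ (proj₂ p) (proj₁ p)))

    cont-unmatched : ∀ X n γ α → (∀ β → (γ , β) ∉ X) → cont Δ X n γ α ≡ 0ℤ
    cont-unmatched X zero γ α _ = refl
    cont-unmatched X (suc n) γ α unmatched = cont-zero X n γ α λ {β} m → ⊥-elim (unmatched β m)

  Position : Set
  Position = Maybe Simplex × Simplex

  -- A walk is a trajectory without its final step.
  Walk : List Pair → Maybe Simplex → Simplex → List Pair → Set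
  Walk X pr β [] = ⊤
  Walk X pr β (p ∷ ps) = p ∈ X × proj₁ p ⊊ β × NotPrev pr (proj₁ p) × Walk X (just (proj₁ p)) (proj₂ p) ps

  walkEnd : Maybe Simplex → Simplex → List Pair → Position
  walkEnd pr β [] = pr , β
  walkEnd pr β (p ∷ ps) = walkEnd (just (proj₁ p)) (proj₂ p) ps

  FinalStep : Position → Simplex → Set
  FinalStep s e = e ⊊ proj₂ s × NotPrev (proj₁ s) e

  nextLower : Simplex → List Pair → Simplex
  nextLower e [] = e
  nextLower e (p ∷ _) = proj₁ p

  walkEnd-++ : ∀ pr β xs ys → walkEnd pr β (xs ++ ys) ≡ walkEnd (proj₁ (walkEnd pr β xs)) (proj₂ (walkEnd pr β xs)) ys
  walkEnd-++ pr β [] ys = refl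
  walkEnd-++ pr β (p ∷ xs) ys = walkEnd-++ _ _ xs ys

  walkEnd-origin : ∀ pr β xs → proj₂ (walkEnd pr β xs) ≡ β ⊎ Σ Pair λ p → p ∈ xs × proj₂ (walkEnd pr β xs) ≡ proj₂ p
  walkEnd-origin pr β [] = inj₁ refl
  walkEnd-origin pr β (p ∷ xs) with walkEnd-origin (just (proj₁ p)) (proj₂ p) xs
  ... | inj₁ e = inj₂ (p , here refl , e)
  ... | inj₂ (q , q∈ , e) = inj₂ (q , there q∈ , e)

  module _ {X : List Pair} where

    chain→walk : ∀ {pr β} ps {e} → Chain X pr β ps e → Walk X pr β ps
    chain→walk [] c = tt
    chain→walk (p ∷ ps) (m , s , n , c) = m , s , n , chain→walk ps c

    walk→chain : ∀ {pr β} ps {e} → Walk X pr β ps → FinalStep (walkEnd pr β ps) e → Chain X pr β ps e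
    walk→chain [] w st = st
    walk→chain (p ∷ ps) (m , s , n , w) st = m , s , n , walk→chain ps w st

    walk-split : ∀ {pr β} xs {ys} → Walk X pr β (xs ++ ys) →
                 Walk X pr β xs × Walk X (proj₁ (walkEnd pr β xs)) (proj₂ (walkEnd pr β xs)) ys
    walk-split [] w = tt , w
    walk-split (p ∷ xs) (m , s , n , w) = let (a , b) = walk-split xs w in (m , s , n , a) , b

    walk-join : ∀ {pr β} xs {ys} → Walk X pr β xs →
                Walk X (proj₁ (walkEnd pr β xs)) (proj₂ (walkEnd pr β xs)) ys → Walk X pr β (xs ++ ys)
    walk-join [] _ w = w
    walk-join (p ∷ xs) (m , s , n , w) w′ = m , s , n , walk-join xs w w′

    chain-split : ∀ {pr β} xs {ys e} → Chain X pr β (xs ++ ys) e →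
                  Walk X pr β xs × Chain X (proj₁ (walkEnd pr β xs)) (proj₂ (walkEnd pr β xs)) ys e
    chain-split [] c = tt , c
    chain-split (p ∷ xs) (m , s , n , c) = let (a , b) = chain-split xs c in (m , s , n , a) , b

    walk-chain-join : ∀ {pr β} xs {ys e} → Walk X pr β xs →
                      Chain X (proj₁ (walkEnd pr β xs)) (proj₂ (walkEnd pr β xs)) ys e → Chain X pr β (xs ++ ys) e
    walk-chain-join [] _ c = c
    walk-chain-join (p ∷ xs) (m , s , n , w) c = m , s , n , walk-chain-join xs w c

    chain-join : ∀ {pr β pr′ β′} xs ys {e} → Chain X pr β xs (nextLower e ys) → Chain X pr′ β′ ys e →
                 Chain X pr β (xs ++ ys) e
    chain-join [] [] c c′ = c
    chain-join [] (p ∷ ys) (s , n) (m , _ , _ , c′) = m , s , n , c′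
    chain-join (q ∷ xs) ys (m , s , n , c) c′ = m , s , n , chain-join xs ys c c′

    chain-prev : ∀ {pr pr′ β} ps {e} → Chain X pr β ps e → NotPrev pr′ (nextLower e ps) → Chain X pr′ β ps e
    chain-prev [] (s , _) n = s , n
    chain-prev (p ∷ ps) (m , s , _ , c) n = m , s , n , c

    walk-∈ : ∀ {pr β} ps → Walk X pr β ps → ∀ {q} → q ∈ ps → q ∈ X
    walk-∈ (p ∷ ps) (m , _) (here refl) = m
    walk-∈ (p ∷ ps) (_ , _ , _ , w) (there q∈) = walk-∈ ps w q∈

    walk-cut : ∀ {pr β} ps → Walk X pr β ps → ∀ {q} → q ∈ ps → Σ (List Pair) λ ps′ → Chain X pr β ps′ (proj₁ q)
    walk-cut (p ∷ ps) (m , s , n , w) (here refl) = [] , s , n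
    walk-cut (p ∷ ps) (m , s , n , w) (there q∈) =
      let (ps′ , c) = walk-cut ps w q∈ in p ∷ ps′ , m , s , n , c

    -- A repeated pair closes a V-path.
    gradient⇒walk-unique : (∀ p ps → ¬ ClosedPath X p ps) → ∀ {pr β} ps → Walk X pr β ps → Unique ps
    gradient⇒walk-unique acyclic [] w = []
    gradient⇒walk-unique acyclic (p ∷ ps) (m , s , n , w) =
      All.tabulate (λ q∈ p≡q → let (ps′ , c) = walk-cut ps w q∈ in
                               acyclic p ps′ (m , subst (Chain X (just (proj₁ p)) (proj₂ p) ps′ ∘ proj₁) (sym p≡q) c))
      ∷ gradient⇒walk-unique acyclic ps w

  walk-⊆ : ∀ {X Y pr β} ps → (∀ {q} → q ∈ ps → q ∈ Y) → Walk X pr β ps → Walk Y pr β ps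
  walk-⊆ [] h w = tt
  walk-⊆ (p ∷ ps) h (m , s , n , w) = h (here refl) , s , n , walk-⊆ ps (h ∘ there) w

  WalkBound : List Pair → ℕ → Set
  WalkBound X b = ∀ {pr β} ps → Walk X pr β ps → length ps ≤ b

  walk-unique⇒bounded : ∀ {X} → (∀ {pr β} ps → Walk X pr β ps → Unique ps) → WalkBound X (length X)
  walk-unique⇒bounded u ps w = unique-⊆⇒length≤ (u ps w) (walk-∈ ps w)

  record FacetPair (p : Pair) : Set where
    field
      lower-sorted : Sorted (proj₁ p)
      upper-sorted : Sorted (proj₂ p)
      lower⊊upper  : proj₁ p ⊊ proj₂ p
      length-suc   : suc (length (proj₁ p)) ≡ length (proj₂ p)
  open FacetPair public

  FacetPairs : List Pair → Set
  FacetPairs X = All FacetPair X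

  DistinctLower : List Pair → Set
  DistinctLower X = AllPairs (λ p q → proj₁ p ≢ proj₁ q) X

  chain-length< : ∀ {X} → FacetPairs X → ∀ {pr β} ps {e} → Sorted e → Chain X pr β ps e → suc (length e) ≤ length β
  chain-length< fp [] se (s , _) = ⊊⇒length< se s
  chain-length< fp (p ∷ ps) se (m , s , n , c) =
    let fpp = All.lookup fp m
    in ℕₚ.≤-trans (chain-length< fp ps se c)
         (ℕₚ.≤-trans (ℕₚ.≤-reflexive (sym (length-suc fpp))) (⊊⇒length< (lower-sorted fpp) s))

  chain-lower-lengths : ∀ {X} → FacetPairs X → ∀ {pr β} ps {e} m → Sorted e → m ≤ length e → length β ≤ suc m →
                        Chain X pr β ps e → All (λ p → length (proj₁ p) ≡ m) ps
  chain-lower-lengths fp [] m se m≤e β≤ c = []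
  chain-lower-lengths fp (p ∷ ps) m se m≤e β≤ (p∈ , a⊊β , _ , c) =
    ℕₚ.≤-antisym a≤m m≤a ∷ chain-lower-lengths fp ps m se m≤e (subst (_≤ suc m) (length-suc fpp) (s≤s a≤m)) c
    where
    fpp : FacetPair p
    fpp = All.lookup fp p∈
    a≤m : length (proj₁ p) ≤ m
    a≤m = ℕₚ.≤-pred (ℕₚ.≤-trans (⊊⇒length< (lower-sorted fpp) a⊊β) β≤)
    m≤a : m ≤ length (proj₁ p)
    m≤a = ℕₚ.≤-trans m≤e (ℕₚ.≤-pred (ℕₚ.≤-trans (chain-length< fp ps se c) (ℕₚ.≤-reflexive (sym (length-suc fpp)))))

  -- trajSum Δ X n counts trajectories with at most n pairs, so it is constant in n once n bounds
  -- the length of all walks.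
  module Stability (Δ : Complex) (X : List Pair) (fp : FacetPairs X) where
    open Incidence Δ

    WalksBounded : ℕ → Maybe Simplex → Simplex → Set
    WalksBounded n pr β = ∀ ps → Walk X pr β ps → length ps ≤ n

    PairWalksBounded : ℕ → Simplex → Set
    PairWalksBounded n γ = ∀ b ps → (γ , b) ∈ X → Walk X (just γ) b ps → suc (length ps) ≤ n

    mutual
      trajSum-suc : ∀ n pr β α → Sorted β → WalksBounded n pr β → trajSum Δ X n pr β α ≡ trajSum Δ X (suc n) pr β α
      trajSum-suc n pr β α sβ bounded = facetSum-cong pr β λ {p} p∈ np →
        cong (kronecker (proj₂ p) α +_)
             (cont-suc n (proj₂ p) α λ b ps m w → bounded ((proj₂ p , b) ∷ ps) (m , facet-⊊ β sβ p∈ , np , w))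

      cont-suc : ∀ n γ α → PairWalksBounded n γ → cont Δ X n γ α ≡ cont Δ X (suc n) γ α
      cont-suc zero γ α bounded = sym (cont-unmatched X 1 γ α λ b m → ℕₚ.<-irrefl refl (bounded b [] m tt))
      cont-suc (suc n) γ α bounded = cont-cong X {n} {suc n} γ α λ {b} m →
        trajSum-suc n (just γ) b α (upper-sorted (All.lookup fp m)) λ ps w → ℕₚ.≤-pred (bounded b ps m w)

    module _ (bound : ℕ) (bounded : WalkBound X bound) where

      cont-stable : ∀ j γ α → cont Δ X (j ℕ.+ bound) γ α ≡ cont Δ X bound γ α
      cont-stable zero γ α = refl
      cont-stable (suc j) γ α = trans (sym (cont-suc (j ℕ.+ bound) γ α pair-bounded)) (cont-stable j γ α)
        where pair-bounded : PairWalksBounded (j ℕ.+ bound) γ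
              pair-bounded β ps m w = ℕₚ.≤-trans (bounded ((γ , β) ∷ ps) (m , lower⊊upper (All.lookup fp m) , tt , w))
                                                 (ℕₚ.m≤n+m bound j)

      trajSum-stable : ∀ j pr β α → Sorted β → trajSum Δ X (j ℕ.+ bound) pr β α ≡ trajSum Δ X bound pr β α
      trajSum-stable zero pr β α s = refl
      trajSum-stable (suc j) pr β α s =
        trans (sym (trajSum-suc (j ℕ.+ bound) pr β α s λ ps w → ℕₚ.≤-trans (bounded ps w) (ℕₚ.m≤n+m bound j)))
              (trajSum-stable j pr β α s)

  module PathSums (Δ : Complex) (X : List Pair) (fp : FacetPairs X) (distinct : DistinctLower X) where
    open Incidence Δ

    partner-facet : ∀ {γ b} → (γ , b) ∈ X → Σ (ℕ × Simplex) λ p → p ∈ facets b × proj₂ p ≡ γ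
    partner-facet m = let fpp = All.lookup fp m in
      ⊆-facet (lower-sorted fpp) (upper-sorted fpp) (proj₁ (lower⊊upper fpp)) (length-suc fpp)

    partner-inc-isUnit : ∀ {γ b} → (γ , b) ∈ X → IsUnit (inc Δ b γ)
    partner-inc-isUnit m with partner-facet m
    ... | p , p∈ , refl = inc-isUnit _ (upper-sorted (All.lookup fp m)) p∈

    facetSum-excluding-partner : ∀ {γ b} (h : Simplex → ℤ) → (γ , b) ∈ X →
                                 facetSum (just γ) b h ≡ facetSum nothing b h - inc Δ b γ * h γ
    facetSum-excluding-partner h m with partner-facet m
    ... | p , p∈ , refl = facetSum-excluding _ h (upper-sorted (All.lookup fp m)) p∈

    cont-matched : ∀ n {γ b} α → (γ , b) ∈ X → cont Δ X (suc n) γ α ≡ (- inc Δ b γ) * trajSum Δ X n (just γ) b α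
    cont-matched n {γ} α m =
      BySource.sumℤ-select-unique X γ (λ q → (- inc Δ (proj₂ q) γ) * trajSum Δ X n (just γ) (proj₂ q) α) distinct m refl

    reach-suc : ∀ n {γ b} α → (γ , b) ∈ X →
                reach X (suc n) γ α ≡ kronecker γ α - inc Δ b γ * pathSum X n b α + reach X n γ α
    reach-suc n {γ} {b} α m = begin
      kronecker γ α + cont Δ X (suc n) γ α
        ≡⟨ cong (kronecker γ α +_) (cont-matched n α m) ⟩
      kronecker γ α + (- ε) * trajSum Δ X n (just γ) b α
        ≡⟨ cong (λ t → kronecker γ α + (- ε) * t) (facetSum-excluding-partner (λ δ → reach X n δ α) m) ⟩
      kronecker γ α + (- ε) * (pathSum X n b α - ε * reach X n γ α)
        ≡⟨ expand (kronecker γ α) (pathSum X n b α) (reach X n γ α) (partner-inc-isUnit m) ⟩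
      kronecker γ α - ε * pathSum X n b α + reach X n γ α ∎
      where
      open ≡-Reasoning
      ε : ℤ
      ε = inc Δ b γ
      expand : ∀ i B f → IsUnit ε → i + (- ε) * (B - ε * f) ≡ i - ε * B + f
      expand i B f εε = trans (ring i ε B f) (trans (cong (λ u → i - ε * B + u * f) (square≡1 εε)) (cong (i - ε * B +_) (ℤₚ.*-identityˡ f)))
        where ring : ∀ i e B f → i + (- e) * (B - e * f) ≡ i - e * B + (e * e) * f
              ring = solve-∀

    -- The coefficient of the pair (γ, b) in reach-suc is pathSum X n b α, so once reach has
    -- stabilised at γ ≠ α, that boundary vanishes.
    pathSum-partner≡0 : ∀ n {γ b} α → (γ , b) ∈ X → γ ≢ α → reach X (suc n) γ α ≡ reach X n γ α → pathSum X n b α ≡ 0ℤ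
    pathSum-partner≡0 n {γ} {b} α m γ≢α stable =
      isUnit-*-zero _ (partner-inc-isUnit m)
        (zero-shift (inc Δ b γ * pathSum X n b α) (reach X n γ α)
          (trans (cong (λ z → z - inc Δ b γ * pathSum X n b α + reach X n γ α) (sym (kronecker-≢ γ α γ≢α)))
                 (trans (sym (reach-suc n α m)) stable)))
      where zero-shift : ∀ x f → 0ℤ - x + f ≡ f → x ≡ 0ℤ
            zero-shift x f e = trans (ring x f) (trans (cong (λ z → f - z) e) (ℤₚ.+-inverseʳ f))
              where ring : ∀ x f → x ≡ f - (0ℤ - x + f)
                    ring = solve-∀

    mutual
      trajSum-off-level : ∀ n pr β α → suc (length α) ≢ length β → trajSum Δ X n pr β α ≡ 0ℤ
      trajSum-off-level n pr β α ne = facetSum-zero pr β λ {p} p∈ _ →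
        let ne′ : length (proj₂ p) ≢ length α
            ne′ e = ne (trans (cong suc (sym e)) (facet-length β p∈))
        in cong₂ _+_ (kronecker-≢ (proj₂ p) α (ne′ ∘ cong length)) (cont-off-level n (proj₂ p) α ne′)

      cont-off-level : ∀ n γ α → length γ ≢ length α → cont Δ X n γ α ≡ 0ℤ
      cont-off-level zero γ α ne = refl
      cont-off-level (suc n) γ α ne = cont-zero X n γ α λ {b} m →
        trajSum-off-level n (just γ) b α λ e → ne (ℕₚ.suc-injective (trans (length-suc (All.lookup fp m)) (sym e)))

    mutual
      trajSum-no-chain : ∀ n pr β e → Sorted β → (∀ ps → ¬ Chain X pr β ps e) → trajSum Δ X n pr β e ≡ 0ℤ
      trajSum-no-chain n pr β e sβ none = facetSum-zero pr β λ {p} p∈ np →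
        let γ⊊β = facet-⊊ β sβ p∈ in
        cong₂ _+_ (kronecker-≢ (proj₂ p) e λ { refl → none [] (γ⊊β , np) })
                  (cont-no-chain n (proj₂ p) e λ b ps m c → none ((proj₂ p , b) ∷ ps) (m , γ⊊β , np , c))

      cont-no-chain : ∀ n γ e → (∀ b ps → (γ , b) ∈ X → ¬ Chain X (just γ) b ps e) → cont Δ X n γ e ≡ 0ℤ
      cont-no-chain zero γ e none = refl
      cont-no-chain (suc n) γ e none = cont-zero X n γ e λ {b} m →
        trajSum-no-chain n (just γ) b e (upper-sorted (All.lookup fp m)) λ ps → none b ps m

    module _ {pr β e ps} (sβ : Sorted β) (unique : ∀ ps′ → Chain X pr β ps′ e → ps′ ≡ ps) where

      reach-off-trajectory : ∀ n {q} → q ∈ facets β → NotPrev pr (proj₂ q) → proj₂ q ≢ nextLower e ps →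
                             reach X n (proj₂ q) e ≡ 0ℤ
      reach-off-trajectory n {q} q∈ np q≢ = cong₂ _+_
        (kronecker-≢ (proj₂ q) e λ q≡e →
          q≢ (trans q≡e (cong (nextLower e) (unique [] (subst (_⊊ β) q≡e q⊊β , subst (NotPrev pr) q≡e np)))))
        (cont-no-chain n (proj₂ q) e λ b ps′ m c′ →
          q≢ (cong (nextLower e) (unique ((proj₂ q , b) ∷ ps′) (m , q⊊β , np , c′))))
        where q⊊β : proj₂ q ⊊ β
              q⊊β = facet-⊊ β sβ q∈

      trajSum-unique : ∀ n {p} → p ∈ facets β → proj₂ p ≡ nextLower e ps → NotPrev pr (proj₂ p) →
                       trajSum Δ X n pr β e ≡ inc Δ β (proj₂ p) * reach X n (proj₂ p) e
      trajSum-unique n p∈ p≡ np = facetSum-single pr β (λ γ → reach X n γ e) sβ p∈ np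
        λ q∈ np′ q≢p → reach-off-trajectory n q∈ np′ λ q≡ → q≢p (trans q≡ (sym p≡))

    first-step-facet : ∀ {pr β e} ps → Sorted β → Sorted e → suc (length e) ≡ length β → Chain X pr β ps e →
                       Σ (ℕ × Simplex) λ p → p ∈ facets β × proj₂ p ≡ nextLower e ps
    first-step-facet [] sβ se len ((sub , _) , _) = ⊆-facet se sβ sub len
    first-step-facet {β = β} {e} ((a , b) ∷ ps) sβ se len (m , a⊊β , _ , c) =
      ⊆-facet (lower-sorted fpp) sβ (proj₁ a⊊β)
        (ℕₚ.≤-antisym (⊊⇒length< (lower-sorted fpp) a⊊β)
          (subst (_≤ suc (length a)) len (ℕₚ.≤-trans (chain-length< fp ps se c) (ℕₚ.≤-reflexive (sym (length-suc fpp))))))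
      where fpp : FacetPair (a , b)
            fpp = All.lookup fp m

    first-NotPrev : ∀ {pr β e} ps → Chain X pr β ps e → NotPrev pr (nextLower e ps)
    first-NotPrev [] (_ , np) = np
    first-NotPrev (_ ∷ _) (_ , _ , np , _) = np

    -- The unique trajectory is the only one trajSum counts, and its weight is a product of incidences ±1.
    mutual
      trajSum-unique-isUnit : ∀ n pr β e ps → Sorted β → Sorted e → (∀ b → (e , b) ∉ X) → suc (length e) ≡ length β →
        Chain X pr β ps e → (∀ ps′ → Chain X pr β ps′ e → ps′ ≡ ps) → length ps ≤ n → IsUnit (trajSum Δ X n pr β e)
      trajSum-unique-isUnit n pr β e ps sβ se unmatched len c unique n≥ with first-step-facet ps sβ se len c
      ... | p , p∈ , p≡ =
        subst IsUnit (sym (trajSum-unique sβ unique n p∈ p≡ (subst (NotPrev pr) (sym p≡) (first-NotPrev ps c))))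
          (isUnit-* (inc-isUnit β sβ p∈)
                    (subst (λ γ → IsUnit (reach X n γ e)) (sym p≡) (reach-first-isUnit n pr β e ps se unmatched len c unique n≥)))

      reach-first-isUnit : ∀ n pr β e ps → Sorted e → (∀ b → (e , b) ∉ X) → suc (length e) ≡ length β →
        Chain X pr β ps e → (∀ ps′ → Chain X pr β ps′ e → ps′ ≡ ps) → length ps ≤ n → IsUnit (reach X n (nextLower e ps) e)
      reach-first-isUnit n pr β e [] _ unmatched _ _ _ _ =
        subst IsUnit (sym (cong₂ _+_ (kronecker-refl e) (cont-unmatched X n e e unmatched))) (isUnit refl)
      reach-first-isUnit (suc n) pr β e ((a , b) ∷ ps) se unmatched len (a∈ , a⊊β , np , c) unique (s≤s n≥) =
        subst IsUnit (sym (trans (cong₂ _+_ (kronecker-≢ a e λ a≡e → unmatched b (subst (λ x → (x , b) ∈ X) a≡e a∈))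
                                            (cont-matched n e a∈))
                                 (ℤₚ.+-identityˡ _)))
          (isUnit-* (isUnit-neg (partner-inc-isUnit a∈))
            (trajSum-unique-isUnit n (just a) b e ps (upper-sorted fpa) se unmatched
              (ℕₚ.≤-antisym (chain-length< fp ps se c)
                 (ℕₚ.≤-trans (ℕₚ.≤-reflexive (sym (length-suc fpa)))
                    (ℕₚ.≤-trans (⊊⇒length< (lower-sorted fpa) a⊊β) (ℕₚ.≤-reflexive (sym len)))))
              c (λ ps′ c′ → Listₚ.∷-injectiveʳ (unique ((a , b) ∷ ps′) (a∈ , a⊊β , np , c′))) n≥))
        where fpa : FacetPair (a , b)
              fpa = All.lookup fp a∈

  ∂-critical : ∀ Δ X β α → Critical Δ X α → ∂ Δ X β α ≡ trajSum Δ X (length X) nothing β α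
  ∂-critical Δ X β α c = cong (λ b → if b then trajSum Δ X (length X) nothing β α else 0ℤ) (dec-true (critical? Δ X α) c)

  ∂-noncritical : ∀ Δ X β α → ¬ Critical Δ X α → ∂ Δ X β α ≡ 0ℤ
  ∂-noncritical Δ X β α nc = cong (λ b → if b then trajSum Δ X (length X) nothing β α else 0ℤ) (dec-false (critical? Δ X α) nc)

  module Cancellation (Δ : Complex) (V : List Pair) (gradV : GradientVF Δ V) (k : ℕ) (k≥1 : 1 ≤ k)
    (σ₀ τ₀ : Simplex) (lσ : length σ₀ ≡ suc k) (lτ : length τ₀ ≡ k)
    (P : List Pair) (canc : Cancellable Δ V σ₀ τ₀ P) where

    open DiscreteVectorField (proj₁ gradV)
    open DecMembership _≟ₚ_ using (_∈?_)
    open Incidence Δ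

    acyclic : ∀ p ps → ¬ ClosedPath V p ps
    acyclic = proj₂ gradV

    σ₀-critical : Critical Δ V σ₀
    σ₀-critical = proj₁ canc

    τ₀-critical : Critical Δ V τ₀
    τ₀-critical = proj₁ (proj₂ canc)

    P-trajectory : Trajectory V σ₀ P τ₀
    P-trajectory = proj₁ (proj₂ (proj₂ canc))

    P-only-trajectory : ∀ P′ → Trajectory V σ₀ P′ τ₀ → P′ ≡ P
    P-only-trajectory = proj₂ (proj₂ (proj₂ canc))

    sortedΔ : ∀ {β} → β ∈ simplices Δ → Sorted β
    sortedΔ = All.lookup (sorted Δ)

    σ₀-sorted : Sorted σ₀
    σ₀-sorted = sortedΔ (proj₁ σ₀-critical)

    τ₀-sorted : Sorted τ₀
    τ₀-sorted = sortedΔ (proj₁ τ₀-critical)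

    τ₀-unmatched : ∀ {p} → p ∈ V → proj₁ p ≢ τ₀
    τ₀-unmatched m = proj₁ (All.lookup (proj₂ (proj₂ τ₀-critical)) m)

    V-facetPairs : FacetPairs V
    V-facetPairs = All.tabulate λ m → record
      { lower-sorted = sortedΔ (proj₁ (All.lookup pairs-in m))
      ; upper-sorted = sortedΔ (proj₂ (All.lookup pairs-in m))
      ; lower⊊upper  = proj₁ (All.lookup pairs-sub m)
      ; length-suc   = sym (proj₂ (All.lookup pairs-sub m))
      }

    V-lower-injective : ∀ {p q} → p ∈ V → q ∈ V → proj₁ p ≡ proj₁ q → p ≡ q
    V-lower-injective {p} p∈ q∈ e = matching p∈ q∈ (proj₁ p) (inj₁ refl) (inj₁ e)

    V-distinct : DistinctLower V
    V-distinct = unique-injective⇒distinct nodup V-lower-injective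

    V-walk-unique : ∀ {pr β} ps → Walk V pr β ps → Unique ps
    V-walk-unique = gradient⇒walk-unique acyclic

    P-walk : Walk V nothing σ₀ P
    P-walk = chain→walk P P-trajectory

    P⊆V : ∀ {q} → q ∈ P → q ∈ V
    P⊆V = walk-∈ P P-walk

    P-unique : Unique P
    P-unique = V-walk-unique P P-walk

    P-distinct : DistinctLower P
    P-distinct = unique-injective⇒distinct P-unique λ p∈ q∈ → V-lower-injective (P⊆V p∈) (P⊆V q∈)

    P-lower-lengths : All (λ p → length (proj₁ p) ≡ k) P
    P-lower-lengths =
      chain-lower-lengths V-facetPairs P k τ₀-sorted (ℕₚ.≤-reflexive (sym lτ)) (ℕₚ.≤-reflexive lσ) P-trajectory

    nonempty : ∀ {x : Simplex} → length x ≡ k → x ≢ []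
    nonempty l refl = ℕₚ.<⇒≢ k≥1 l

    -- Splitting P = xs ++ ys after i = length xs pairs: upperAt xs is the i-th upper simplex β_i
    -- of the trajectory (β₀ = σ₀) and lowerAt ys the next lower simplex α_{i+1} (α_{r+1} = τ₀).
    upperAt : List Pair → Simplex
    upperAt xs = proj₂ (walkEnd nothing σ₀ xs)

    lowerAt : List Pair → Simplex
    lowerAt = nextLower τ₀

    split-∈ˡ : ∀ {xs ys p} → xs ++ ys ≡ P → p ∈ xs → p ∈ P
    split-∈ˡ e m = subst (_ ∈_) e (∈-++⁺ˡ m)

    split-∈ʳ : ∀ {xs ys p} → xs ++ ys ≡ P → p ∈ ys → p ∈ P
    split-∈ʳ {xs} e m = subst (_ ∈_) e (∈-++⁺ʳ xs m)

    split-chain : ∀ xs ys → xs ++ ys ≡ P → Chain V nothing σ₀ (xs ++ ys) τ₀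
    split-chain xs ys e = subst (λ L → Chain V nothing σ₀ L τ₀) (sym e) P-trajectory

    lowerAt-nonempty : ∀ {xs ys} → xs ++ ys ≡ P → lowerAt ys ≢ []
    lowerAt-nonempty {ys = []} _ = nonempty lτ
    lowerAt-nonempty {xs} {p ∷ _} e = nonempty (All.lookup P-lower-lengths (split-∈ʳ {xs} e (here refl)))

    kept : List Pair
    kept = filter (λ p → ¬? (p ∈? P)) V

    reversedAlong : Simplex → List Pair → List Pair
    reversedAlong β L = zip (map proj₁ L ++ [ τ₀ ]) (β ∷ map proj₂ L)

    reversed : List Pair
    reversed = reversedAlong σ₀ P

    -- W is kept ++ reversed by definition.
    W : List Pair
    W = cancel V σ₀ P τ₀

    reversed-∈⁻ : ∀ pr β L {q} → q ∈ reversedAlong β L → Σ (List Pair) λ xs → Σ (List Pair) λ ys →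
                  xs ++ ys ≡ L × q ≡ (lowerAt ys , proj₂ (walkEnd pr β xs))
    reversed-∈⁻ pr β [] (here refl) = [] , [] , refl , refl
    reversed-∈⁻ pr β (p ∷ L) (here refl) = [] , p ∷ L , refl , refl
    reversed-∈⁻ pr β (p ∷ L) (there m) =
      let (xs , ys , e , q≡) = reversed-∈⁻ (just (proj₁ p)) (proj₂ p) L m in p ∷ xs , ys , cong (p ∷_) e , q≡

    reversed-∈⁺ : ∀ pr β xs ys → (lowerAt ys , proj₂ (walkEnd pr β xs)) ∈ reversedAlong β (xs ++ ys)
    reversed-∈⁺ pr β [] [] = here refl
    reversed-∈⁺ pr β [] (p ∷ ys) = here refl
    reversed-∈⁺ pr β (p ∷ xs) ys = there (reversed-∈⁺ (just (proj₁ p)) (proj₂ p) xs ys)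

    reversed-at : ∀ xs ys → xs ++ ys ≡ P → (lowerAt ys , upperAt xs) ∈ reversed
    reversed-at xs ys e = subst (λ L → (lowerAt ys , upperAt xs) ∈ reversedAlong σ₀ L) e (reversed-∈⁺ nothing σ₀ xs ys)

    reversed-lower : ∀ β L {q} → q ∈ reversedAlong β L → proj₁ q ∈ map proj₁ L ++ [ τ₀ ]
    reversed-lower β [] (here refl) = here refl
    reversed-lower β (p ∷ L) (here refl) = here refl
    reversed-lower β (p ∷ L) (there m) = there (reversed-lower (proj₂ p) L m)

    reversed-length : ∀ β L → length (reversedAlong β L) ≡ suc (length L)
    reversed-length β [] = refl
    reversed-length β (p ∷ L) = cong suc (reversed-length (proj₂ p) L)

    reversed-facetPairs : ∀ pr β L → Sorted β → length β ≡ suc k → Chain V pr β L τ₀ →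
                          All (λ p → length (proj₁ p) ≡ k) L → FacetPairs (reversedAlong β L)
    reversed-facetPairs pr β [] sβ lβ (τ₀⊊β , _) _ =
      record { lower-sorted = τ₀-sorted ; upper-sorted = sβ ; lower⊊upper = τ₀⊊β ; length-suc = trans (cong suc lτ) (sym lβ) } ∷ []
    reversed-facetPairs pr β ((a , b) ∷ L) sβ lβ (m , a⊊β , _ , c) (la ∷ lL) =
      record { lower-sorted = lower-sorted fpp ; upper-sorted = sβ ; lower⊊upper = a⊊β ; length-suc = trans (cong suc la) (sym lβ) }
      ∷ reversed-facetPairs (just a) b L (upper-sorted fpp) (trans (sym (length-suc fpp)) (cong suc la)) c lL
      where fpp : FacetPair (a , b)
            fpp = All.lookup V-facetPairs m

    reversed-distinct : ∀ β L → AllPairs _≢_ (map proj₁ L ++ [ τ₀ ]) → DistinctLower (reversedAlong β L)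
    reversed-distinct β [] _ = [] ∷ []
    reversed-distinct β (p ∷ L) (p∉ ∷ u) =
      All.tabulate (λ q∈ → All.lookup p∉ (reversed-lower (proj₂ p) L q∈)) ∷ reversed-distinct (proj₂ p) L u

    ∉P? : (p : Pair) → Dec (p ∉ P)
    ∉P? p = ¬? (p ∈? P)

    kept⇒W : ∀ {p} → p ∈ V → p ∉ P → p ∈ W
    kept⇒W m n = ∈-++⁺ˡ (∈-filter⁺ ∉P? m n)

    reversed⇒W : ∀ {q} → q ∈ reversed → q ∈ W
    reversed⇒W = ∈-++⁺ʳ kept

    W-∈⁻ : ∀ {p} → p ∈ W → (p ∈ V × p ∉ P) ⊎ p ∈ reversed
    W-∈⁻ m with ∈-++⁻ kept m
    ... | inj₁ m′ = inj₁ (∈-filter⁻ ∉P? m′)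
    ... | inj₂ m′ = inj₂ m′

    reversed-lower-length : ∀ {q} → q ∈ reversed → length (proj₁ q) ≡ k
    reversed-lower-length q∈ with ∈-++⁻ (map proj₁ P) (reversed-lower σ₀ P q∈)
    ... | inj₁ m = let (p , p∈ , e) = ∈-map⁻ proj₁ m in trans (cong length e) (All.lookup P-lower-lengths p∈)
    ... | inj₂ (here e) = trans (cong length e) lτ

    reversed∩V⊆P : ∀ {q} → q ∈ reversed → q ∈ V → q ∈ P
    reversed∩V⊆P m q∈V with reversed-∈⁻ nothing σ₀ P m
    ... | xs , [] , e , refl = ⊥-elim (τ₀-unmatched q∈V refl)
    ... | xs , p ∷ ys , e , refl =
      let p∈P = split-∈ʳ {xs} e (here refl) in subst (_∈ P) (sym (V-lower-injective q∈V (P⊆V p∈P) refl)) p∈P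

    W-distinct : DistinctLower W
    W-distinct = AllPairsₚ.++⁺ (AllPairsₚ.filter⁺ ∉P? V-distinct) (reversed-distinct σ₀ P reversed-lowers-distinct)
                   (All.tabulate λ p∈ → All.tabulate λ q∈ → kept-reversed-distinct p∈ q∈)
      where
      reversed-lowers-distinct : AllPairs _≢_ (map proj₁ P ++ [ τ₀ ])
      reversed-lowers-distinct = AllPairsₚ.++⁺ (AllPairsₚ.map⁺ P-distinct) ([] ∷ [])
        (All.tabulate λ x∈ → (λ e → let (p , p∈ , e′) = ∈-map⁻ proj₁ x∈ in τ₀-unmatched (P⊆V p∈) (trans (sym e′) e)) ∷ [])
      kept-reversed-distinct : ∀ {p q} → p ∈ kept → q ∈ reversed → proj₁ p ≢ proj₁ q
      kept-reversed-distinct p∈ q∈ e with ∈-filter⁻ ∉P? p∈ | ∈-++⁻ (map proj₁ P) (reversed-lower σ₀ P q∈)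
      ... | p∈V , p∉P | inj₁ m = let (p′ , p′∈ , e′) = ∈-map⁻ proj₁ m in
                                 p∉P (subst (_∈ P) (sym (V-lower-injective p∈V (P⊆V p′∈) (trans e e′))) p′∈)
      ... | p∈V , _ | inj₂ (here e′) = τ₀-unmatched p∈V (trans e e′)

    W-facetPairs : FacetPairs W
    W-facetPairs = Allₚ.++⁺ (Allₚ.filter⁺ ∉P? V-facetPairs) (reversed-facetPairs nothing σ₀ P σ₀-sorted lσ P-trajectory P-lower-lengths)

    τ₀-W-matched : (τ₀ , upperAt P) ∈ W
    τ₀-W-matched = reversed⇒W (reversed-at P [] (Listₚ.++-identityʳ P))

    σ₀-W-matched : (lowerAt P , σ₀) ∈ W
    σ₀-W-matched = reversed⇒W (reversed-at [] P refl)

    V-lower-W-matched : ∀ {p} → p ∈ V → Σ Simplex λ b → (proj₁ p , b) ∈ W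
    V-lower-W-matched {p} p∈ with p ∈? P
    ... | no p∉ = proj₂ p , kept⇒W p∈ p∉
    ... | yes p∈P with ∈-∃++ p∈P
    ...   | xs , ys , e = upperAt xs , reversed⇒W (reversed-at xs (p ∷ ys) (sym e))

    P-upper-W-matched : ∀ {p} → p ∈ P → Σ Simplex λ a → a ≢ [] × (a , proj₂ p) ∈ W
    P-upper-W-matched {p} p∈P with ∈-∃++ p∈P
    ... | xs , ys , e =
      lowerAt ys , lowerAt-nonempty {xs ++ [ p ]} split ,
      reversed⇒W (subst (λ β → (lowerAt ys , β) ∈ reversed) (cong proj₂ (walkEnd-++ nothing σ₀ xs [ p ]))
                        (reversed-at (xs ++ [ p ]) ys split))
      where split : (xs ++ [ p ]) ++ ys ≡ P
            split = trans (Listₚ.++-assoc xs [ p ] ys) (sym e)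

    W-critical⇒V-critical : ∀ {α} → Critical Δ W α → Critical Δ V α
    W-critical⇒V-critical {α} (α∈Δ , α≢[] , allW) = α∈Δ , α≢[] , All.tabulate λ {p} p∈ → lower-ok p∈ , upper-ok p∈
      where
      lower-ok : ∀ {p} → p ∈ V → proj₁ p ≢ α
      lower-ok p∈ = proj₁ (All.lookup allW (proj₂ (V-lower-W-matched p∈)))
      upper-ok : ∀ {p} → p ∈ V → proj₂ p ≡ α → proj₁ p ≡ []
      upper-ok {p} p∈ p₂≡α with p ∈? P
      ... | no p∉ = proj₂ (All.lookup allW (kept⇒W p∈ p∉)) p₂≡α
      ... | yes p∈P = let (a , a≢[] , m) = P-upper-W-matched p∈P in ⊥-elim (a≢[] (proj₂ (All.lookup allW m) p₂≡α))

    V-critical⇒W-critical : ∀ {α} → Critical Δ V α → α ≢ σ₀ → α ≢ τ₀ → Critical Δ W α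
    V-critical⇒W-critical {α} (α∈Δ , α≢[] , allV) α≢σ₀ α≢τ₀ =
      α∈Δ , α≢[] , Allₚ.++⁺ (Allₚ.filter⁺ ∉P? allV) (All.tabulate reversed-ok)
      where
      reversed-ok : ∀ {q} → q ∈ reversed → proj₁ q ≢ α × (proj₂ q ≡ α → proj₁ q ≡ [])
      reversed-ok q∈ with reversed-∈⁻ nothing σ₀ P q∈
      ... | xs , ys , e , refl = lower-ok ys (split-∈ʳ {xs} e) , upper-ok
        where
        lower-ok : ∀ ys → (∀ {q} → q ∈ ys → q ∈ P) → lowerAt ys ≢ α
        lower-ok [] _ e′ = α≢τ₀ (sym e′)
        lower-ok (p ∷ ys) ⊆P = proj₁ (All.lookup allV (P⊆V (⊆P (here refl))))
        upper-ok : upperAt xs ≡ α → lowerAt ys ≡ []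
        upper-ok e′ with walkEnd-origin nothing σ₀ xs
        ... | inj₁ e″ = ⊥-elim (α≢σ₀ (trans (sym e′) e″))
        ... | inj₂ (p , p∈ , e″) =
          let p∈P = split-∈ˡ {xs} e p∈ in
          ⊥-elim (nonempty (All.lookup P-lower-lengths p∈P) (proj₂ (All.lookup allV (P⊆V p∈P)) (trans (sym e″) e′)))

    σ₀-not-W-critical : ¬ Critical Δ W σ₀
    σ₀-not-W-critical (_ , _ , allW) = lowerAt-nonempty {[]} refl (proj₂ (All.lookup allW σ₀-W-matched) refl)

    τ₀-not-W-critical : ¬ Critical Δ W τ₀
    τ₀-not-W-critical (_ , _ , allW) = proj₁ (All.lookup allW τ₀-W-matched) refl

    -- W and V differ only in pairs whose lower simplex has k vertices.
    mutual
      trajSum-W≡V : ∀ n pr β α → length β ≢ suc k → trajSum Δ W n pr β α ≡ trajSum Δ V n pr β α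
      trajSum-W≡V n pr β α ne = facetSum-cong pr β λ {p} p∈ _ →
        cong (kronecker (proj₂ p) α +_) (cont-W≡V n (proj₂ p) α λ e → ne (trans (sym (facet-length β p∈)) (cong suc e)))

      cont-W≡V : ∀ n γ α → length γ ≢ k → cont Δ W n γ α ≡ cont Δ V n γ α
      cont-W≡V zero γ α ne = refl
      cont-W≡V (suc n) γ α ne = begin
        sumℤ (map (select γ gW) (kept ++ reversed))
          ≡⟨ cong sumℤ (Listₚ.map-++ (select γ gW) kept reversed) ⟩
        sumℤ (map (select γ gW) kept ++ map (select γ gW) reversed)
          ≡⟨ sumℤ-++ (map (select γ gW) kept) (map (select γ gW) reversed) ⟩
        sumℤ (map (select γ gW) kept) + sumℤ (map (select γ gW) reversed)
          ≡⟨ cong₂ _+_ kept-part reversed-part ⟩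
        sumℤ (map (select γ gV) V) + 0ℤ
          ≡⟨ ℤₚ.+-identityʳ _ ⟩
        sumℤ (map (select γ gV) V) ∎
        where
        open ≡-Reasoning
        open BySource
        gW : Pair → ℤ
        gW = λ q → (- inc Δ (proj₂ q) γ) * trajSum Δ W n (just γ) (proj₂ q) α
        gV : Pair → ℤ
        gV = λ q → (- inc Δ (proj₂ q) γ) * trajSum Δ V n (just γ) (proj₂ q) α
        term : ∀ p → p ∈ V → select γ gW p ≡ select γ gV p
        term p p∈ with proj₁ p ≟ₛ γ
        ... | no _ = refl
        ... | yes refl = cong ((- inc Δ (proj₂ p) (proj₁ p)) *_)
                (trajSum-W≡V n (just (proj₁ p)) (proj₂ p) α λ e → ne (ℕₚ.suc-injective (trans (length-suc (All.lookup V-facetPairs p∈)) e)))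
        kept-part : sumℤ (map (select γ gW) kept) ≡ sumℤ (map (select γ gV) V)
        kept-part = trans (sumℤ-map-cong kept (λ {p} p∈ → term p (proj₁ (∈-filter⁻ ∉P? p∈))))
          (sumℤ-map-filter ∉P? (select γ gV) V λ {p} _ p∈P → select-≢ γ gV p λ e →
            ne (trans (sym (cong length e)) (All.lookup P-lower-lengths (decidable-stable (p ∈? P) p∈P))))
        reversed-part : sumℤ (map (select γ gW) reversed) ≡ 0ℤ
        reversed-part = sumℤ-select-none reversed γ gW λ q∈ e → ne (trans (sym (cong length e)) (reversed-lower-length q∈))

    length-V≤W : length V ≤ length W
    length-V≤W = begin
      length V                                           ≤⟨ split-length V nodup ⟩
      length kept ℕ.+ length P                           ≤⟨ ℕₚ.+-monoʳ-≤ (length kept) (ℕₚ.n≤1+n _) ⟩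
      length kept ℕ.+ suc (length P)                     ≡⟨ cong (length kept ℕ.+_) (sym (reversed-length σ₀ P)) ⟩
      length kept ℕ.+ length reversed                    ≡⟨ sym (Listₚ.length-++ kept) ⟩
      length W                                           ∎
      where
      open ℕₚ.≤-Reasoning
      partition : ∀ xs → length xs ≤ length (filter ∉P? xs) ℕ.+ length (filter (_∈? P) xs)
      partition [] = z≤n
      partition (x ∷ xs) with x ∈? P
      ... | yes _ = subst (suc (length xs) ≤_) (sym (ℕₚ.+-suc _ _)) (s≤s (partition xs))
      ... | no _ = s≤s (partition xs)
      split-length : ∀ xs → Unique xs → length xs ≤ length (filter ∉P? xs) ℕ.+ length P
      split-length xs u = ℕₚ.≤-trans (partition xs) (ℕₚ.+-monoʳ-≤ (length (filter ∉P? xs))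
        (unique-⊆⇒length≤ (AllPairsₚ.filter⁺ (_∈? P) u) (λ m → proj₂ (∈-filter⁻ (_∈? P) {xs = xs} m))))

    module StableV = Stability Δ V V-facetPairs
    module SumsV = PathSums Δ V V-facetPairs V-distinct

    V-bounded : WalkBound V (length V)
    V-bounded = walk-unique⇒bounded V-walk-unique

    trajSum-V-stable : ∀ pr β α → Sorted β → trajSum Δ V (length W) pr β α ≡ trajSum Δ V (length V) pr β α
    trajSum-V-stable pr β α s =
      trans (cong (λ m → trajSum Δ V m pr β α) (sym (ℕₚ.m∸n+n≡m length-V≤W)))
            (StableV.trajSum-stable (length V) V-bounded (length W ℕ.∸ length V) pr β α s)

    -- A simplex that is V- but not W-critical is σ₀ or τ₀, and their level rules out trajectories from β.
    ∂-V-vanishes : ∀ β α → ¬ Critical Δ W α → (α ≡ σ₀ → length β ≢ suc (suc k)) → (α ≡ τ₀ → length β ≢ suc k) →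
                   ∂ Δ V β α ≡ 0ℤ
    ∂-V-vanishes β α ¬αW σ₀-far τ₀-far with critical? Δ V α
    ... | no ¬αV = ∂-noncritical Δ V β α ¬αV
    ... | yes αV with α ≟ₛ σ₀ | α ≟ₛ τ₀
    ...   | yes refl | _ = trans (∂-critical Δ V β α αV)
                             (SumsV.trajSum-off-level (length V) nothing β α λ e → σ₀-far refl (trans (sym e) (cong suc lσ)))
    ...   | no _ | yes refl = trans (∂-critical Δ V β α αV)
                                (SumsV.trajSum-off-level (length V) nothing β α λ e → τ₀-far refl (trans (sym e) (cong suc lτ)))
    ...   | no α≢σ₀ | no α≢τ₀ = ⊥-elim (¬αW (V-critical⇒W-critical αV α≢σ₀ α≢τ₀))

    ∂-W≡V-off-level : ∀ β α → Critical Δ W β → length β ≢ suc k → (α ≡ σ₀ → length β ≢ suc (suc k)) →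
                      ∂ Δ W β α ≡ ∂ Δ V β α
    ∂-W≡V-off-level β α β-crit β≢ σ₀-far with critical? Δ W α
    ... | yes α-crit = begin
      ∂ Δ W β α                            ≡⟨ ∂-critical Δ W β α α-crit ⟩
      trajSum Δ W (length W) nothing β α   ≡⟨ trajSum-W≡V (length W) nothing β α β≢ ⟩
      trajSum Δ V (length W) nothing β α   ≡⟨ trajSum-V-stable nothing β α (sortedΔ (proj₁ β-crit)) ⟩
      trajSum Δ V (length V) nothing β α   ≡⟨ sym (∂-critical Δ V β α (W-critical⇒V-critical α-crit)) ⟩
      ∂ Δ V β α                            ∎
      where open ≡-Reasoning
    ... | no ¬α-crit = trans (∂-noncritical Δ W β α ¬α-crit) (sym (∂-V-vanishes β α ¬α-crit σ₀-far (λ _ → β≢)))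

    -- Along a W-walk the reversed pairs (α_{i+1}, β_i) are used with strictly decreasing i: going
    -- down from β_i through kept pairs to some α_{j+1} with j ≥ i and then following P would give
    -- a second V-trajectory from σ₀ to τ₀.
    IndexBelow : Pair → ℕ → Set
    IndexBelow q i = ∀ xs ys → xs ++ ys ≡ P → q ≡ (lowerAt ys , upperAt xs) → length xs < i

    ReversedIndicesBelow : ℕ → List Pair → Set
    ReversedIndicesBelow i qs = All (λ q → q ∈ reversed → IndexBelow q i) qs

    junction-NotPrev : ∀ xs ys → xs ++ ys ≡ P → ∀ seg → All (_∉ P) seg → Walk V (just (lowerAt ys)) (upperAt xs) seg →
                       ∀ xs′ ys′ → xs′ ++ ys′ ≡ P → length xs ≤ length xs′ →
                       NotPrev (proj₁ (walkEnd nothing σ₀ xs)) (lowerAt (seg ++ ys′))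
    junction-NotPrev xs ys e seg seg∉P w xs′ ys′ e′ i≤j with initLast xs
    ... | [] = tt
    ... | xs₀ ∷ʳ′ p = subst (λ s → NotPrev (proj₁ s) (lowerAt (seg ++ ys′))) (sym (walkEnd-++ nothing σ₀ xs₀ [ p ]))
                            (lower-differs seg seg∉P w)
      where
      p∈P : p ∈ P
      p∈P = split-∈ˡ {xs₀ ++ [ p ]} e (∈-++⁺ʳ xs₀ (here refl))
      later-lower-differs : ∀ zs → xs′ ++ zs ≡ P → proj₁ p ≢ lowerAt zs
      later-lower-differs [] _ same = τ₀-unmatched (P⊆V p∈P) same
      later-lower-differs (p′ ∷ zs) e″ same = ℕₚ.<-irrefl position i<j
        where
        p≡p′ : p ≡ p′
        p≡p′ = V-lower-injective (P⊆V p∈P) (P⊆V (split-∈ʳ {xs′} e″ (here refl))) same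
        at-xs₀ : xs₀ ++ p ∷ ys ≡ P
        at-xs₀ = trans (sym (Listₚ.++-assoc xs₀ [ p ] ys)) e
        at-xs′ : xs′ ++ p ∷ zs ≡ P
        at-xs′ = subst (λ z → xs′ ++ z ∷ zs ≡ P) (sym p≡p′) e″
        position : length xs₀ ≡ length xs′
        position = unique-split-position xs₀ ys xs′ zs (subst Unique (sym at-xs₀) P-unique) (trans at-xs₀ (sym at-xs′))
        i<j : suc (length xs₀) ≤ length xs′
        i<j = subst (_≤ length xs′) (trans (Listₚ.length-++ xs₀) (ℕₚ.+-comm (length xs₀) 1)) i≤j
      lower-differs : ∀ seg → All (_∉ P) seg → Walk V (just (lowerAt ys)) (upperAt (xs₀ ++ [ p ])) seg →
                      proj₁ p ≢ lowerAt (seg ++ ys′)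
      lower-differs (s ∷ _) (s∉P ∷ _) (s∈V , _) same = s∉P (subst (_∈ P) (V-lower-injective (P⊆V p∈P) s∈V same) p∈P)
      lower-differs [] _ _ same = later-lower-differs ys′ e′ same

    kept-descent-impossible : ∀ xs ys → xs ++ ys ≡ P → ∀ seg → All (_∉ P) seg → Walk V (just (lowerAt ys)) (upperAt xs) seg →
                              ∀ xs′ ys′ → xs′ ++ ys′ ≡ P → length xs ≤ length xs′ →
                              ¬ FinalStep (walkEnd (just (lowerAt ys)) (upperAt xs) seg) (lowerAt ys′)
    kept-descent-impossible xs ys e seg seg∉P w xs′ ys′ e′ i≤j step =
      ends-differently seg seg∉P (proj₂ step) (Listₚ.++-cancelˡ xs (seg ++ ys′) ys (trans (P-only-trajectory _ second) (sym e)))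
      where
      second : Chain V nothing σ₀ (xs ++ seg ++ ys′) τ₀
      second = walk-chain-join xs (proj₁ (chain-split xs (split-chain xs ys e)))
        (chain-prev (seg ++ ys′)
          (chain-join seg ys′ (walk→chain seg w step) (proj₂ (chain-split xs′ (split-chain xs′ ys′ e′))))
          (junction-NotPrev xs ys e seg seg∉P w xs′ ys′ e′ i≤j))
      ends-differently : ∀ seg → All (_∉ P) seg → NotPrev (proj₁ (walkEnd (just (lowerAt ys)) (upperAt xs) seg)) (lowerAt ys′) →
                         seg ++ ys′ ≢ ys
      ends-differently [] _ np same = np (cong lowerAt (sym same))
      ends-differently (s ∷ seg) (s∉P ∷ _) _ same = s∉P (split-∈ʳ {xs} e (subst (s ∈_) same (here refl)))

    W-walk-reversed-decreasing : ∀ xs ys → xs ++ ys ≡ P → ∀ seg → All (_∉ P) seg → Walk V (just (lowerAt ys)) (upperAt xs) seg →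
      ∀ qs → Walk W (proj₁ (walkEnd (just (lowerAt ys)) (upperAt xs) seg)) (proj₂ (walkEnd (just (lowerAt ys)) (upperAt xs) seg)) qs →
      ReversedIndicesBelow (length xs) qs
    W-walk-reversed-decreasing xs ys e seg seg∉P w-seg [] _ = []
    W-walk-reversed-decreasing xs ys e seg seg∉P w-seg (q ∷ qs) (q∈W , q⊊ , np , w) with W-∈⁻ q∈W
    ... | inj₁ (q∈V , q∉P) =
      (λ q∈rev → ⊥-elim (q∉P (reversed∩V⊆P q∈rev q∈V)))
      ∷ W-walk-reversed-decreasing xs ys e (seg ++ [ q ]) (Allₚ.++⁺ seg∉P (q∉P ∷ [])) (walk-join seg w-seg (q∈V , q⊊ , np , tt)) qs
          (subst (λ s → Walk W (proj₁ s) (proj₂ s) qs) (sym (walkEnd-++ (just (lowerAt ys)) (upperAt xs) seg [ q ])) w)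
    ... | inj₂ q∈rev with reversed-∈⁻ nothing σ₀ P q∈rev
    ...   | xs′ , ys′ , e′ , refl =
      here-below ∷ All.map (λ below q∈ xs″ ys″ e″ q≡ → ℕₚ.<-trans (below q∈ xs″ ys″ e″ q≡) j<i) rest
      where
      here-below : (lowerAt ys′ , upperAt xs′) ∈ reversed → IndexBelow (lowerAt ys′ , upperAt xs′) (length xs)
      here-below _ xs″ ys″ e″ q≡ with length xs″ ℕ.<? length xs
      ... | yes below = below
      ... | no ¬below = ⊥-elim (kept-descent-impossible xs ys e seg seg∉P w-seg xs″ ys″ e″ (ℕₚ.≮⇒≥ ¬below)
                          (subst (_⊊ _) (cong proj₁ q≡) q⊊ , subst (NotPrev _) (cong proj₁ q≡) np))
      j<i : length xs′ < length xs
      j<i = here-below q∈rev xs′ ys′ e′ refl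
      rest : ReversedIndicesBelow (length xs′) qs
      rest = W-walk-reversed-decreasing xs′ ys′ e′ [] [] tt qs w

    reversed-used-once : ∀ {pr β} as {q} bs → Walk W pr β (as ++ q ∷ bs) → q ∈ reversed → q ∉ bs
    reversed-used-once as bs w q∈rev q∈bs with walk-split {X = W} as w
    ... | _ , (_ , _ , _ , w-bs) with reversed-∈⁻ nothing σ₀ P q∈rev
    ...   | xs , ys , e , refl =
      ℕₚ.<-irrefl refl (All.lookup (W-walk-reversed-decreasing xs ys e [] [] tt bs w-bs) q∈bs q∈rev xs ys e refl)

    open DecMembership _≟ₚ_ using () renaming (_∈?_ to _∈ₚ?_)

    -- Between two occurrences of a kept pair p, a W-walk either repeats a reversed pair or uses only
    -- kept pairs, and then closes a V-path.
    W-walk-no-repeat : ∀ {pr β} p ps → Walk W pr β (p ∷ ps) → p ∉ ps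
    W-walk-no-repeat p ps w@(p∈W , _ , _ , w′) p∈ps with p ∈ₚ? reversed | W-∈⁻ p∈W
    ... | yes p∈rev | _ = reversed-used-once [] ps w p∈rev p∈ps
    ... | no p∉rev | inj₂ p∈rev = p∉rev p∈rev
    ... | no _ | inj₁ (p∈V , _) with ∈-∃++ p∈ps
    ...   | mid , _ , refl with walk-split {X = W} mid w′
    ...     | w-mid , (p∈W′ , p⊊ , np , _) with Any.any? (_∈ₚ? reversed) mid
    ...       | yes some =
      let (q , q∈mid , q∈rev) = find some
          (as , bs , mid≡) = ∈-∃++ q∈mid
          twice : Walk W (just (proj₁ p)) (proj₂ p) (as ++ q ∷ (bs ++ p ∷ mid))
          twice = subst (Walk W (just (proj₁ p)) (proj₂ p))
                        (trans (cong (_++ p ∷ mid) mid≡) (Listₚ.++-assoc as (q ∷ bs) (p ∷ mid)))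
                        (walk-join mid w-mid (p∈W′ , p⊊ , np , w-mid))
      in reversed-used-once as (bs ++ p ∷ mid) twice q∈rev (∈-++⁺ʳ bs (there q∈mid))
    ...       | no none = acyclic p mid (p∈V , walk→chain mid (walk-⊆ mid mid⊆V w-mid) (p⊊ , np))
      where
      mid⊆V : ∀ {x} → x ∈ mid → x ∈ V
      mid⊆V x∈ with W-∈⁻ (walk-∈ mid w-mid x∈)
      ... | inj₁ (x∈V , _) = x∈V
      ... | inj₂ x∈rev = ⊥-elim (none (lose x∈ x∈rev))

    W-walk-unique : ∀ {pr β} ps → Walk W pr β ps → Unique ps
    W-walk-unique [] w = []
    W-walk-unique (p ∷ ps) w =
      All.tabulate (λ q∈ p≡q → W-walk-no-repeat p ps w (subst (_∈ ps) (sym p≡q) q∈)) ∷ W-walk-unique ps (proj₂ (proj₂ (proj₂ w)))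

    W-bounded : WalkBound W (length W)
    W-bounded = walk-unique⇒bounded W-walk-unique

    module StableW = Stability Δ W W-facetPairs
    module SumsW = PathSums Δ W W-facetPairs W-distinct

    pathSum-V-partner≡0 : ∀ {γ b} x → (γ , b) ∈ V → Critical Δ V x → pathSum V (length V) b x ≡ 0ℤ
    pathSum-V-partner≡0 {γ} x m x-crit =
      SumsV.pathSum-partner≡0 (length V) x m (proj₁ (All.lookup (proj₂ (proj₂ x-crit)) m))
        (cong (kronecker γ x +_) (StableV.cont-stable (length V) V-bounded 1 γ x))

    a₀₀ : ℤ
    a₀₀ = pathSum V (length V) σ₀ τ₀

    a₀₀-isUnit : IsUnit a₀₀
    a₀₀-isUnit = SumsV.trajSum-unique-isUnit (length V) nothing σ₀ τ₀ P σ₀-sorted τ₀-sorted (λ b m → τ₀-unmatched m refl)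
                   (trans (cong suc lτ) (sym lσ)) P-trajectory P-only-trajectory (V-bounded P P-walk)

    -- At a W-pair (γ, b) the facet sum of corrected over b vanishes: for kept pairs as V-boundaries
    -- of a partner, for b = σ₀ because a₀₀² = 1.
    module Correction (α : Simplex) (α-crit : Critical Δ W α) where

      b₀ : ℤ
      b₀ = pathSum V (length V) σ₀ α

      corrected : Simplex → ℤ
      corrected γ = reach V (length V) γ α - (a₀₀ * b₀) * reach V (length V) γ τ₀

      facetSum-corrected : ∀ β → facetSum nothing β corrected ≡ pathSum V (length V) β α - (a₀₀ * b₀) * pathSum V (length V) β τ₀
      facetSum-corrected β = facetSum-linear β (a₀₀ * b₀) (λ γ → reach V (length V) γ α) (λ γ → reach V (length V) γ τ₀)

      facetSum-corrected-V-partner : ∀ {γ b} → (γ , b) ∈ V → facetSum nothing b corrected ≡ 0ℤ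
      facetSum-corrected-V-partner {b = b} m =
        trans (facetSum-corrected b)
          (trans (cong₂ (λ x y → x - (a₀₀ * b₀) * y) (pathSum-V-partner≡0 α m (W-critical⇒V-critical α-crit))
                                                      (pathSum-V-partner≡0 τ₀ m τ₀-critical))
                 (cong (λ z → 0ℤ - z) (ℤₚ.*-zeroʳ (a₀₀ * b₀))))

      facetSum-corrected-σ₀ : facetSum nothing σ₀ corrected ≡ 0ℤ
      facetSum-corrected-σ₀ = trans (facetSum-corrected σ₀) (unit-cancels a₀₀-isUnit)
        where unit-cancels : IsUnit a₀₀ → b₀ - (a₀₀ * b₀) * a₀₀ ≡ 0ℤ
              unit-cancels aa = trans (ring a₀₀ b₀) (trans (cong (λ u → b₀ - u * b₀) (square≡1 aa))
                                  (trans (cong (λ z → b₀ - z) (ℤₚ.*-identityˡ b₀)) (ℤₚ.+-inverseʳ b₀)))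
                where ring : ∀ a b → b - (a * b) * a ≡ b - (a * a) * b
                      ring = solve-∀

      facetSum-corrected-W-partner : ∀ {γ b} → (γ , b) ∈ W → facetSum nothing b corrected ≡ 0ℤ
      facetSum-corrected-W-partner m with W-∈⁻ m
      ... | inj₁ (m′ , _) = facetSum-corrected-V-partner m′
      ... | inj₂ q∈rev with reversed-∈⁻ nothing σ₀ P q∈rev
      ...   | xs , ys , e , refl with walkEnd-origin nothing σ₀ xs
      ...     | inj₁ at-σ₀ = trans (cong (λ β → facetSum nothing β corrected) at-σ₀) facetSum-corrected-σ₀
      ...     | inj₂ (p , p∈ , at-p) = trans (cong (λ β → facetSum nothing β corrected) at-p)
                                            (facetSum-corrected-V-partner (P⊆V (split-∈ˡ {xs} e p∈)))

      corrected-unmatched : ∀ γ → (∀ b → (γ , b) ∉ W) → corrected γ ≡ kronecker γ α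
      corrected-unmatched γ W-unmatched =
        trans (cong₂ (λ x y → x - (a₀₀ * b₀) * y) (reach-unmatched α) (trans (reach-unmatched τ₀) (kronecker-≢ γ τ₀ γ≢τ₀)))
              (trans (cong (λ z → kronecker γ α - z) (ℤₚ.*-zeroʳ (a₀₀ * b₀))) (ℤₚ.+-identityʳ (kronecker γ α)))
        where
        γ≢τ₀ : γ ≢ τ₀
        γ≢τ₀ refl = W-unmatched _ τ₀-W-matched
        V-unmatched : ∀ b → (γ , b) ∉ V
        V-unmatched b m = let (b′ , m′) = V-lower-W-matched m in W-unmatched b′ m′
        reach-unmatched : ∀ x → reach V (length V) γ x ≡ kronecker γ x
        reach-unmatched x = trans (cong (kronecker γ x +_) (cont-unmatched V (length V) γ x V-unmatched)) (ℤₚ.+-identityʳ _)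

      reach-W≡corrected : ∀ m γ → StableW.PairWalksBounded m γ → reach W m γ α ≡ corrected γ
      reach-W≡corrected m γ bounded with Any.any? (λ p → proj₁ p ≟ₛ γ) W
      ... | no none = trans (trans (cong (kronecker γ α +_) (cont-unmatched W m γ α unmatched)) (ℤₚ.+-identityʳ _))
                            (sym (corrected-unmatched γ unmatched))
        where unmatched : ∀ b → (γ , b) ∉ W
              unmatched b m = none (lose m refl)
      ... | yes some with find some
      ...   | (_ , b) , p∈ , refl with m
      ...     | zero = ⊥-elim (ℕₚ.<-irrefl refl (bounded b [] p∈ tt))
      ...     | suc m′ = begin
        kronecker γ α + cont Δ W (suc m′) γ α
          ≡⟨ cong₂ _+_ (kronecker-≢ γ α (proj₁ (All.lookup (proj₂ (proj₂ α-crit)) p∈))) (SumsW.cont-matched m′ α p∈) ⟩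
        0ℤ + (- ε) * facetSum (just γ) b (λ δ → reach W m′ δ α)
          ≡⟨ cong (λ t → 0ℤ + (- ε) * t) (facetSum-cong (just γ) b λ {q} q∈ np → reach-W≡corrected m′ (proj₂ q) (below q∈ np)) ⟩
        0ℤ + (- ε) * facetSum (just γ) b corrected
          ≡⟨ cong (λ t → 0ℤ + (- ε) * t) (trans (SumsW.facetSum-excluding-partner corrected p∈)
                                               (cong (λ z → z - ε * corrected γ) (facetSum-corrected-W-partner p∈))) ⟩
        0ℤ + (- ε) * (0ℤ - ε * corrected γ)
          ≡⟨ ring ε (corrected γ) ⟩
        ε * (ε * corrected γ)
          ≡⟨ isUnit-cancel (corrected γ) (SumsW.partner-inc-isUnit p∈) ⟩
        corrected γ ∎
        where
        open ≡-Reasoning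
        ε : ℤ
        ε = inc Δ b γ
        ring : ∀ e s → 0ℤ + (- e) * (0ℤ - e * s) ≡ e * (e * s)
        ring = solve-∀
        below : ∀ {q} → q ∈ facets b → NotPrev (just γ) (proj₂ q) → StableW.PairWalksBounded m′ (proj₂ q)
        below {q} q∈ np b′ ps m″ w =
          ℕₚ.≤-pred (bounded b ((proj₂ q , b′) ∷ ps) p∈ (m″ , facet-⊊ b (upper-sorted (All.lookup W-facetPairs p∈)) q∈ , np , w))

      trajSum-W-corrected : ∀ σ → trajSum Δ W (length W) nothing σ α ≡
                            pathSum V (length V) σ α - (a₀₀ * b₀) * pathSum V (length V) σ τ₀
      trajSum-W-corrected σ = trans (facetSum-cong nothing σ λ {q} _ _ → reach-W≡corrected (length W) (proj₂ q) (W-pair-bounded (proj₂ q)))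
                                    (facetSum-corrected σ)
        where W-pair-bounded : ∀ γ → StableW.PairWalksBounded (length W) γ
              W-pair-bounded γ b ps m w = W-bounded ((γ , b) ∷ ps) (m , lower⊊upper (All.lookup W-facetPairs m) , tt , w)

    ∂-W-formula : ∀ σ → length σ ≡ suc k → ∀ α → α ≢ τ₀ →
                  ∂ Δ W σ α ≡ ∂ Δ V σ α - (∂ Δ V σ₀ τ₀ * ∂ Δ V σ τ₀) * ∂ Δ V σ₀ α
    ∂-W-formula σ lσ′ α α≢τ₀ with critical? Δ W α
    ... | yes α-crit = begin
      ∂ Δ W σ α                                                   ≡⟨ ∂-critical Δ W σ α α-crit ⟩
      trajSum Δ W (length W) nothing σ α                          ≡⟨ Correction.trajSum-W-corrected α α-crit σ ⟩
      pathSum V (length V) σ α - (a₀₀ * b₀) * pathSum V (length V) σ τ₀  ≡⟨ ring (pathSum V (length V) σ α) a₀₀ b₀ _ ⟩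
      pathSum V (length V) σ α - (a₀₀ * pathSum V (length V) σ τ₀) * b₀  ≡⟨ sym (cong₂ (λ x y → x - y) (∂V σ α αV)
                                                                        (cong₂ _*_ (cong₂ _*_ (∂V σ₀ τ₀ τ₀-critical) (∂V σ τ₀ τ₀-critical)) (∂V σ₀ α αV))) ⟩
      ∂ Δ V σ α - (∂ Δ V σ₀ τ₀ * ∂ Δ V σ τ₀) * ∂ Δ V σ₀ α         ∎
      where
      open ≡-Reasoning
      open Correction α α-crit using (b₀)
      αV : Critical Δ V α
      αV = W-critical⇒V-critical α-crit
      ∂V : ∀ β x → Critical Δ V x → ∂ Δ V β x ≡ pathSum V (length V) β x
      ∂V β x = ∂-critical Δ V β x
      ring : ∀ x a b y → x - (a * b) * y ≡ x - (a * y) * b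
      ring = solve-∀
    ... | no ¬α-crit = trans (∂-noncritical Δ W σ α ¬α-crit) (sym (trans
      (cong₂ (λ x y → x - (∂ Δ V σ₀ τ₀ * ∂ Δ V σ τ₀) * y) (vanishes σ lσ′) (vanishes σ₀ lσ))
      (cong (λ z → 0ℤ - z) (ℤₚ.*-zeroʳ (∂ Δ V σ₀ τ₀ * ∂ Δ V σ τ₀)))))
      where vanishes : ∀ β → length β ≡ suc k → ∂ Δ V β α ≡ 0ℤ
            vanishes β lβ = ∂-V-vanishes β α ¬α-crit (λ _ e → ℕₚ.1+n≢n (trans (sym e) lβ)) (λ α≡τ₀ → ⊥-elim (α≢τ₀ α≡τ₀))

    ∂-W-σ₀≡0 : ∀ β → ∂ Δ W β σ₀ ≡ 0ℤ
    ∂-W-σ₀≡0 β = ∂-noncritical Δ W β σ₀ σ₀-not-W-critical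

    ∂-W-τ₀≡0 : ∀ β → ∂ Δ W β τ₀ ≡ 0ℤ
    ∂-W-τ₀≡0 β = ∂-noncritical Δ W β τ₀ τ₀-not-W-critical

  2+n≢n : ∀ {n} → suc (suc n) ≢ n
  2+n≢n {n} e = ℕₚ.<-irrefl (sym e) (ℕₚ.<-trans (ℕₚ.n<1+n n) (ℕₚ.n<1+n (suc n)))

  apart⇒≢ : ∀ {k q} → k ℕ.+ 1 < q ⊎ q ℕ.+ 1 < k → q ≢ k × q ≢ suc k
  apart⇒≢ {k} (inj₁ k+1<q) = (λ { refl → ℕₚ.m+n≮m k 1 k+1<q }) , (λ { refl → ℕₚ.<-irrefl (ℕₚ.+-comm k 1) k+1<q })
  apart⇒≢ {k} (inj₂ q+1<k) =
    (λ { refl → ℕₚ.m+n≮m k 1 q+1<k }) , (λ { refl → ℕₚ.<-asym (ℕₚ.n<1+n k) (ℕₚ.≤-trans (ℕₚ.m≤m+n (suc (suc k)) 1) q+1<k) })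

open import Defs
open import Data.Nat using (ℕ; suc; _<_; _≤_; _+_)
open import Data.Integer using (0ℤ) renaming (_*_ to _*ℤ_; _-_ to _-ℤ_)
open import Data.List using (List; length)
open import Data.Product using (_×_)
open import Data.Sum using (_⊎_)
open import Relation.Binary.PropositionalEquality using (_≡_; _≢_)
import Data.Nat.Properties as ℕₚ
open import Data.Empty using (⊥-elim)
open import Data.Product using (_,_; proj₁; proj₂)
open import Function using (_∘_)
open import Relation.Binary.PropositionalEquality using (sym; trans)

theorem1p1 : (Δ : Complex) (d : ℕ) → HasDim Δ d →
    (V : List Pair) → GradientVF Δ V →
    (k : ℕ) → 1 ≤ k → k ≤ d →
    (σ₀ τ₀ : Simplex) → length σ₀ ≡ suc k → length τ₀ ≡ k →
    (P : List Pair) → Cancellable Δ V σ₀ τ₀ P →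
    (∀ q → (k + 1 < q ⊎ q + 1 < k) → ∀ β → Critical Δ (cancel V σ₀ P τ₀) β → length β ≡ suc q →
    ∀ α → ∂ Δ (cancel V σ₀ P τ₀) β α ≡ ∂ Δ V β α)
    × (∀ β → Critical Δ (cancel V σ₀ P τ₀) β → length β ≡ suc (suc k) →
    (∀ α → α ≢ σ₀ → ∂ Δ (cancel V σ₀ P τ₀) β α ≡ ∂ Δ V β α)
    × ∂ Δ (cancel V σ₀ P τ₀) β σ₀ ≡ 0ℤ)
    × (∀ β → Critical Δ (cancel V σ₀ P τ₀) β → length β ≡ k →
    ∀ α → ∂ Δ (cancel V σ₀ P τ₀) β α ≡ ∂ Δ V β α)
    × (∀ σ → Critical Δ (cancel V σ₀ P τ₀) σ → length σ ≡ suc k →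
    (∀ α → α ≢ τ₀ → ∂ Δ (cancel V σ₀ P τ₀) σ α
    ≡ ∂ Δ V σ α -ℤ ((∂ Δ V σ₀ τ₀ *ℤ ∂ Δ V σ τ₀) *ℤ ∂ Δ V σ₀ α))
    × ∂ Δ (cancel V σ₀ P τ₀) σ τ₀ ≡ 0ℤ)
theorem1p1 Δ _ _ V gradV k k≥1 _ σ₀ τ₀ lσ lτ P canc =
    (λ q apart β β-crit lβ α →
       ∂-W≡V-off-level β α β-crit (λ e → proj₁ (apart⇒≢ {k} {q} apart) (ℕₚ.suc-injective (trans (sym lβ) e)))
                                   (λ _ e → proj₂ (apart⇒≢ {k} {q} apart) (ℕₚ.suc-injective (trans (sym lβ) e))))
  , (λ β β-crit lβ →
       (λ α α≢σ₀ → ∂-W≡V-off-level β α β-crit (λ e → ℕₚ.1+n≢n (trans (sym lβ) e)) (⊥-elim ∘ α≢σ₀))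
     , ∂-W-σ₀≡0 β)
  , (λ β β-crit lβ α →
       ∂-W≡V-off-level β α β-crit (λ e → ℕₚ.1+n≢n (trans (sym e) lβ))
                                   (λ _ e → 2+n≢n (trans (sym e) lβ)))
  , (λ σ _ lσ′ → ∂-W-formula σ lσ′ , ∂-W-τ₀≡0 σ)
  where
  open MorseCancellation
  open Cancellation Δ V gradV k k≥1 σ₀ τ₀ lσ lτ P canc
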